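{- Consider the map from Baxter slicings to triples of non-intersecting lattice paths defined below. The image of the set of Schröder slicings under this map is exactly the set of Schröder triples of non-intersecting lattice paths. Hence this map restricts to a size-preserving bijection between Schröder slicings and Schröder triples of non-intersecting lattice paths. The map is defined as follows. Place a Baxter slicing of $P$ with bottom-left corner at $(0,0)$. Then: - $u$ is the upper border of $P$ without its first and last steps, translated to start at $(0,2)$; - $d$ is the lower border of $P$ without its first and last steps, translated to start at $(2,0)$; - $m$ is the path from $(1,1)$ to the top-right corner of $P$ following the lower border of every horizontal block and the left border of every vertical block. The slicing is sent to $(u,m,d)$.
   Context: Parallelogram polyominoes are edge-connected sets of unit cells bounded by two $N=(0,1)$/$E=(1,0)$ lattice paths meeting only at their endpoints. The size is $k+\ell-1$ for a $k\times\ell$ bounding rectangle. A Baxter slicing of size $n$ is such a polyomino $P$ divided into $n$ blocks, defined recursively: - for $n=1$, the single cell is the single block; - for $n\ge2$, one block is either the topmost row (horizontal block) or the rightmost column (vertical block), and the other blocks form a Baxter slicing of the remainder. For a horizontal block $u$: - $\ell(u)$ is its width; - $X(u)$ is the lowest point of the lower border of $P$ with the abscissa of the right edge of $u$; - $r(u)$ is the number of horizontal steps of the lower border read leftwards from $X(u)$ before a vertical step or the bottom-left corner is met. A Schröder slicing is a Baxter slicing with $\ell(u)\le r(u)+1$ for every horizontal block $u$. A path of size $n$ is a sequence of $n-1$ steps, each $N$ or $E$. A triple of non-intersecting lattice paths of size $n$ is a triple $(u,m,d)$ of paths of size $n$ with the same number of $E$ steps, starting respectively at $(0,2)$, $(1,1)$,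 $(2,0)$, whose embeddings never meet. In such a triple: - an $N$ step $N_u$ of $u$ and an $N$ step $N_m$ of $m$ are matched if, for some $i$, each is the $i$-th $N$ step of its path; - likewise, $E$ steps $E_m$ of $m$ and $E_d$ of $d$ are matched if, for some $i$, each is the $i$-th $E$ step of its path; - $h_u(N_u)$ (resp. $h_m(N_m)$) is the number of $E$ steps of $u$ (resp. $m$) before $N_u$ (resp. $N_m$); - for an $E$ step $E_d$ of $d$, $k_d(E_d)$ is the largest $k$ such that $E^k$ is a factor of $d$ ending at $E_d$. A Schröder triple is a triple such that the following holds for every $N$ step $N_u$ of $u$. Let $N_m$ be the $N$ step of $m$ matched with $N_u$, let $E_m$ be the last $E$ step of $m$ before $N_m$, and let $E_d$ be the $E$ step of $d$ matched with $E_m$. Then $h_u(N_u)-h_m(N_m)\le k_d(E_d)$. -}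

module Defs where

open import Data.Nat using (ℕ; zero; suc; _+_; _∸_; _≤_; _<_)
open import Data.List using (List; []; _∷_; _++_; reverse; take; drop; replicate; length)
open import Data.Maybe using (Maybe; just; nothing)
open import Data.Product using (_×_; _,_)
open import Data.Empty using (⊥)
open import Data.List.Membership.Propositional using (_∈_)
open import Relation.Binary.PropositionalEquality using (_≡_)

data Step : Set where
  N E : Step

Path : Set
Path = List Step

Point : Set
Point = ℕ × ℕ

countE : Path → ℕ
countE []      = 0
countE (N ∷ s) = countE s
countE (E ∷ s) = suc (countE s)

countN : Path → ℕ
countN []      = 0
countN (N ∷ s) = suc (countN s)
countN (E ∷ s) = countN s

count : Step → Path → ℕ
count N s = countN s
count E s = countE s

at : Path → ℕ → Maybe Step
at []      _       = nothing
at (x ∷ s) zero    = just x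
at (x ∷ s) (suc p) = at s p

leadingE : Path → ℕ
leadingE (E ∷ s) = suc (leadingE s)
leadingE _       = 0

leadingN : Path → ℕ
leadingN (N ∷ s) = suc (leadingN s)
leadingN _       = 0

trailingE trailingN : Path → ℕ
trailingE s = leadingE (reverse s)
trailingN s = leadingN (reverse s)

dropTrailingE dropTrailingN : Path → Path
dropTrailingE s = reverse (drop (trailingE s) (reverse s))
dropTrailingN s = reverse (drop (trailingN s) (reverse s))

runE : Path → ℕ → ℕ
runE s p = leadingE (reverse (take (suc p) s))

dropLast : Path → Path
dropLast []          = []
dropLast (x ∷ [])    = []
dropLast (x ∷ y ∷ s) = x ∷ dropLast (y ∷ s)

inner : Path → Path
inner []      = []
inner (_ ∷ s) = dropLast s

vertices : Point → Path → List Point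
vertices p       []      = p ∷ []
vertices (x , y) (N ∷ s) = (x , y) ∷ vertices (x , suc y) s
vertices (x , y) (E ∷ s) = (x , y) ∷ vertices (suc x , y) s

Disjoint : List Point → List Point → Set
Disjoint xs ys = ∀ p → p ∈ xs → p ∈ ys → ⊥

-- A parallelogram polyomino with bottom-left corner (0,0) and top-right
-- corner (k,l) is given by its upper border U (starts with N, ends with E)
-- and lower border L (starts with E, ends with N), both from (0,0) to (k,l).
-- Blocks are rectangles of cells [x,x+w] × [y,y+h].

data Kind : Set where
  hor ver base : Kind

record Block : Set where
  constructor block
  field
    kind : Kind
    x y w h : ℕ

-- abscissa where the topmost row of P starts (upper border U)
topStart : Path → ℕ
topStart U = countE U ∸ trailingE U

-- ordinate where the rightmost column of P starts (lower border L)
rightStart : Path → ℕ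
rightStart L = countN L ∸ trailingN L

-- upper border after putting a new topmost row [a , k] on top of P
addRow : ℕ → Path → Path
addRow a U = dropTrailingE U ++ replicate (a ∸ topStart U) E
               ++ (N ∷ replicate (countE U ∸ a) E)

-- lower border after putting a new rightmost column [b , l] right of P
addCol : ℕ → Path → Path
addCol b L = dropTrailingN L ++ replicate (b ∸ rightStart L) N
               ++ (E ∷ replicate (countN L ∸ b) N)

-- BaxterSlicing U L bs : the polyomino with borders U, L, divided into the
-- blocks bs, is a Baxter slicing (its size is length bs).  The last block
-- placed is the topmost row (hblock) or the rightmost column (vblock);
-- the remaining blocks form a Baxter slicing of the remainder.
data BaxterSlicing : Path → Path → List Block → Set where
  one    : BaxterSlicing (N ∷ E ∷ []) (E ∷ N ∷ []) (block base 0 0 1 1 ∷ [])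
  hblock : ∀ {U L bs} (a : ℕ) → BaxterSlicing U L bs →
           topStart U ≤ a → a < countE U →
           BaxterSlicing (addRow a U) (L ++ N ∷ [])
                         (block hor a (countN U) (countE U ∸ a) 1 ∷ bs)
  vblock : ∀ {U L bs} (b : ℕ) → BaxterSlicing U L bs →
           rightStart L ≤ b → b < countN L →
           BaxterSlicing (U ++ E ∷ []) (addCol b L)
                         (block ver (countE U) b 1 (countN U ∸ b) ∷ bs)

-- Schröder slicings: every horizontal block u has ℓ(u) ≤ r(u) + 1.
-- The lowest point X(u) of the lower border L with abscissa x+w is the end
-- of the (x+w)-th E step of L (at position p); r(u) is then the length of
-- the maximal run of E steps of L ending at position p.
SchroderSlicing : Path → List Block → Set
SchroderSlicing L bs =
  ∀ b → b ∈ bs → Block.kind b ≡ hor →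
  ∀ p → at L p ≡ just E → suc (countE (take p L)) ≡ Block.x b + Block.w b →
  Block.w b ≤ suc (runE L p)

record Triple : Set where
  constructor triple
  field
    up mid down : Path

record NITriple (n : ℕ) (t : Triple) : Set where
  open Triple t
  field
    len-u : suc (length up)   ≡ n
    len-m : suc (length mid)  ≡ n
    len-d : suc (length down) ≡ n
    E-um  : countE up  ≡ countE mid
    E-md  : countE mid ≡ countE down
    disj-um : Disjoint (vertices (0 , 2) up)  (vertices (1 , 1) mid)
    disj-ud : Disjoint (vertices (0 , 2) up)  (vertices (2 , 0) down)
    disj-md : Disjoint (vertices (1 , 1) mid) (vertices (2 , 0) down)

IsNth : Step → Path → ℕ → ℕ → Set
IsNth x s i p = (at s p ≡ just x) × (count x (take p s) ≡ i)

LastEBefore : Path → ℕ → ℕ → Set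
LastEBefore s q e = (at s e ≡ just E) × (e < q) ×
                    (∀ e' → e < e' → e' < q → at s e' ≡ just N)

-- Schröder condition: for N_u (position pu), its matched N_m (position pm),
-- the last E step E_m of m before N_m (position pe) and the E step E_d of d
-- matched with E_m (position pd):  h_m(N_m) - h_u(N_u) ≤ k_d(E_d).
SchroderCond : Triple → Set
SchroderCond (triple u m d) =
  ∀ i j pu pm pe pd →
  IsNth N u i pu → IsNth N m i pm → LastEBefore m pm pe →
  IsNth E m j pe → IsNth E d j pd →
  countE (take pm m) ≤ runE d pd + countE (take pu u)

SchroderTriple : ℕ → Triple → Set
SchroderTriple n t = NITriple n t × SchroderCond t

-- m: passes through the top-right corners of the successive polyominoes:
-- an N step for each horizontal block, an E step for each vertical one
midPath : ∀ {U L bs} → BaxterSlicing U L bs → Path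
midPath one              = []
midPath (hblock a s _ _) = midPath s ++ N ∷ []
midPath (vblock b s _ _) = midPath s ++ E ∷ []

Φ : ∀ {U L bs} → BaxterSlicing U L bs → Triple
Φ {U} {L} s = triple (inner U) (midPath s) (inner L)

{-# OPTIONS --safe #-}

-- Φ is built block by block.  Placing a new topmost row on a slicing inserts an N step
-- into u (where the row starts) and appends N to m and to d; placing a new rightmost
-- column appends E to u and to m and inserts an E step into d.  Since the borders of a
-- parallelogram polyomino never meet, every prefix of u has at most as many E steps as
-- the same prefix of m, and likewise for m and d; this prefix dominance is equivalent
-- to the three translated paths being disjoint.  Conversely, any dominated triple is
-- peeled uniquely from its last step of m: an N forces d to end in N and determines the
-- row from the last N of u, an E forces u to end in E and determines the column from
-- the last E of d.  Hence Φ is a bijection onto non-intersecting triples.  Under a row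
-- step, the inequality ℓ(u) ≤ r(u) + 1 of the new row is exactly the Schröder condition
-- of the triple at the new matched pair of N steps, while earlier rows and conditions
-- are unaffected; a column step changes neither side.  By induction Schröder slicings
-- correspond to Schröder triples.

module Submission where

open import Defs
open import Data.Nat using (ℕ; zero; suc; _+_; _∸_; _≤_; _<_; z≤n; s≤s; _⊓_; s≤s⁻¹)
open import Data.Nat.Properties
open import Data.List using (List; []; _∷_; _++_; reverse; take; drop; replicate; length; initLast; _∷ʳ′_)
open import Data.List.Properties
open import Data.Maybe using (just)
open import Data.Product using (Σ; _×_; _,_; proj₁; proj₂; uncurry)
open import Data.Sum using (_⊎_; inj₁; inj₂)
open import Data.Empty using (⊥-elim)
open import Relation.Binary.PropositionalEquality
open import Algebra.Properties.CommutativeSemigroup +-commutativeSemigroup using (x∙yz≈y∙xz; interchange)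
open import Relation.Nullary using (yes; no; ¬_)
open import Data.List.Relation.Unary.Any using (here; there)
open import Data.List.Membership.Propositional using (_∈_)
open import Data.Product.Function.NonDependent.Propositional using (_×-⇔_)
open import Function.Bundles using (_⇔_; mk⇔; Equivalence)
open import Function.Related.Propositional using (module EquationalReasoning; equivalence)
open import Data.List.Reverse using (Reverse; []; _∶_∶ʳ_; reverseView)
open import Data.List.Relation.Binary.Permutation.Propositional using (_↭_; ↭-reflexive)
open import Function.Properties.Equivalence using () renaming (refl to ⇔-refl; sym to ⇔-sym; trans to ⇔-trans)

-- Counting steps

other : Step → Step
other N = E
other E = N

self≢other : ∀ c → c ≢ other c
self≢other N ()
self≢other E ()

δ : Step → Step → ℕ
δ N N = 1
δ E E = 1
δ N E = 0
δ E N = 0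

δ-self : ∀ c → δ c c ≡ 1
δ-self N = refl
δ-self E = refl

δ-other : ∀ c → δ c (other c) ≡ 0
δ-other N = refl
δ-other E = refl

δ≤1 : ∀ c x → δ c x ≤ 1
δ≤1 N N = s≤s z≤n
δ≤1 E E = s≤s z≤n
δ≤1 N E = z≤n
δ≤1 E N = z≤n

δ-cases : ∀ c x → (x ≡ c × δ c x ≡ 1) ⊎ (x ≡ other c × δ c x ≡ 0)
δ-cases N N = inj₁ (refl , refl)
δ-cases E E = inj₁ (refl , refl)
δ-cases N E = inj₂ (refl , refl)
δ-cases E N = inj₂ (refl , refl)

count-[] : ∀ c → count c [] ≡ 0
count-[] N = refl
count-[] E = refl

count-∷ : ∀ c x xs → count c (x ∷ xs) ≡ δ c x + count c xs
count-∷ N N xs = refl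
count-∷ N E xs = refl
count-∷ E N xs = refl
count-∷ E E xs = refl

count-self∷ : ∀ c xs → count c (c ∷ xs) ≡ suc (count c xs)
count-self∷ c xs = trans (count-∷ c c xs) (cong (_+ count c xs) (δ-self c))

count-other∷ : ∀ c xs → count c (other c ∷ xs) ≡ count c xs
count-other∷ c xs = trans (count-∷ c (other c) xs) (cong (_+ count c xs) (δ-other c))

count-++ : ∀ c xs ys → count c (xs ++ ys) ≡ count c xs + count c ys
count-++ c []       ys = cong (_+ count c ys) (sym (count-[] c))
count-++ c (x ∷ xs) ys = begin
  count c (x ∷ xs ++ ys)             ≡⟨ count-∷ c x (xs ++ ys) ⟩
  δ c x + count c (xs ++ ys)         ≡⟨ cong (δ c x +_) (count-++ c xs ys) ⟩
  δ c x + (count c xs + count c ys)  ≡⟨ +-assoc (δ c x) _ _ ⟨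
  δ c x + count c xs + count c ys    ≡⟨ cong (_+ count c ys) (count-∷ c x xs) ⟨
  count c (x ∷ xs) + count c ys      ∎
  where open ≡-Reasoning

count-insert : ∀ c xs x ys → count c (xs ++ x ∷ ys) ≡ δ c x + count c (xs ++ ys)
count-insert c xs x ys = begin
  count c (xs ++ x ∷ ys)             ≡⟨ count-++ c xs (x ∷ ys) ⟩
  count c xs + count c (x ∷ ys)      ≡⟨ cong (count c xs +_) (count-∷ c x ys) ⟩
  count c xs + (δ c x + count c ys)  ≡⟨ x∙yz≈y∙xz (count c xs) (δ c x) _ ⟩
  δ c x + (count c xs + count c ys)  ≡⟨ cong (δ c x +_) (count-++ c xs ys) ⟨
  δ c x + count c (xs ++ ys)         ∎
  where open ≡-Reasoning

count-∷ʳ : ∀ c xs x → count c (xs ++ x ∷ []) ≡ δ c x + count c xs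
count-∷ʳ c xs x = trans (count-insert c xs x []) (cong (λ ys → δ c x + count c ys) (++-identityʳ xs))

count≤length : ∀ c xs → count c xs ≤ length xs
count≤length c []       = ≤-reflexive (count-[] c)
count≤length c (x ∷ xs) =
  subst (_≤ suc (length xs)) (sym (count-∷ c x xs)) (+-mono-≤ (δ≤1 c x) (count≤length c xs))

countE+countN≡length : ∀ s → countE s + countN s ≡ length s
countE+countN≡length []      = refl
countE+countN≡length (N ∷ s) = trans (+-suc (countE s) (countN s)) (cong suc (countE+countN≡length s))
countE+countN≡length (E ∷ s) = cong suc (countE+countN≡length s)

countN-≡ : ∀ u m → length u ≡ length m → countE u ≡ countE m → countN u ≡ countN m
countN-≡ u m len eqE = +-cancelˡ-≡ (countE u) _ _ (begin
  countE u + countN u  ≡⟨ countE+countN≡length u ⟩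
  length u             ≡⟨ len ⟩
  length m             ≡⟨ countE+countN≡length m ⟨
  countE m + countN m  ≡⟨ cong (_+ countN m) eqE ⟨
  countE u + countN m  ∎)
  where open ≡-Reasoning

count-replicate-self : ∀ c r → count c (replicate r c) ≡ r
count-replicate-self c zero    = count-[] c
count-replicate-self c (suc r) = trans (count-self∷ c _) (cong suc (count-replicate-self c r))

count-replicate-other : ∀ c r → count c (replicate r (other c)) ≡ 0
count-replicate-other c zero    = count-[] c
count-replicate-other c (suc r) = trans (count-other∷ c _) (count-replicate-other c r)

count-++-replicate-other : ∀ c xs r → count c (xs ++ replicate r (other c)) ≡ count c xs
count-++-replicate-other c xs r = begin
  count c (xs ++ replicate r (other c))           ≡⟨ count-++ c xs _ ⟩
  count c xs + count c (replicate r (other c))    ≡⟨ cong (count c xs +_) (count-replicate-other c r) ⟩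
  count c xs + 0                                  ≡⟨ +-identityʳ _ ⟩
  count c xs                                      ∎
  where open ≡-Reasoning

count≡0⇒replicate-other : ∀ c s → count c s ≡ 0 → s ≡ replicate (length s) (other c)
count≡0⇒replicate-other c []      _  = refl
count≡0⇒replicate-other c (x ∷ s) eq with δ-cases c x
... | inj₁ (_ , δ≡1) = ⊥-elim (1+n≢0 (trans (cong (_+ count c s) (sym δ≡1)) (trans (sym (count-∷ c x s)) eq)))
... | inj₂ (x≡ , δ≡0) = cong₂ _∷_ x≡
  (count≡0⇒replicate-other c s (trans (cong (_+ count c s) (sym δ≡0)) (trans (sym (count-∷ c x s)) eq)))

split-last : ∀ c s → count c s ≢ 0 → Σ Path λ x → Σ ℕ λ r → s ≡ x ++ c ∷ replicate r (other c)
split-last c []      c≢0 = ⊥-elim (c≢0 (count-[] c))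
split-last c (x ∷ s) c≢0 with count c s ≟ 0
... | no  s≢0 = let (y , r , eq) = split-last c s s≢0 in x ∷ y , r , cong (x ∷_) eq
... | yes s≡0 with δ-cases c x
...   | inj₁ (x≡c , _) = [] , length s , cong₂ _∷_ x≡c (count≡0⇒replicate-other c s s≡0)
...   | inj₂ (_ , δ≡0) = ⊥-elim (c≢0 (trans (count-∷ c x s) (cong₂ _+_ δ≡0 s≡0)))

data Position (n : ℕ) : ℕ → Set where
  inside : ∀ {p} → p < n → Position n p
  beyond : ∀ q → Position n (n + q)

position : ∀ n p → Position n p
position zero    p       = beyond p
position (suc n) zero    = inside (s≤s z≤n)
position (suc n) (suc p) with position n p
... | inside p<n = inside (s≤s p<n)
... | beyond q   = beyond q

take-++ˡ : ∀ {A : Set} p (xs ys : List A) → p ≤ length xs → take p (xs ++ ys) ≡ take p xs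
take-++ˡ zero    xs       ys _         = refl
take-++ˡ (suc p) (x ∷ xs) ys (s≤s p≤) = cong (x ∷_) (take-++ˡ p xs ys p≤)

take-++ʳ : ∀ {A : Set} q (xs ys : List A) → take (length xs + q) (xs ++ ys) ≡ xs ++ take q ys
take-++ʳ q []       ys = refl
take-++ʳ q (x ∷ xs) ys = cong (x ∷_) (take-++ʳ q xs ys)

take-length-++ : ∀ {A : Set} (xs ys : List A) → take (length xs) (xs ++ ys) ≡ xs
take-length-++ []       ys = refl
take-length-++ (x ∷ xs) ys = cong (x ∷_) (take-length-++ xs ys)

drop-replicate-++ : ∀ {A : Set} k j (c : A) w → drop (k + j) (replicate k c ++ w) ≡ drop j w
drop-replicate-++ zero    j c w = refl
drop-replicate-++ (suc k) j c w = drop-replicate-++ k j c w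

replicate-+ : ∀ {A : Set} m n (c : A) → replicate (m + n) c ≡ replicate m c ++ replicate n c
replicate-+ zero    n c = refl
replicate-+ (suc m) n c = cong (c ∷_) (replicate-+ m n c)

replicate-∷ʳ : ∀ {A : Set} r (c : A) → replicate r c ++ c ∷ [] ≡ replicate (suc r) c
replicate-∷ʳ zero    c = refl
replicate-∷ʳ (suc r) c = cong (c ∷_) (replicate-∷ʳ r c)

reverse-replicate : ∀ {A : Set} r (c : A) → reverse (replicate r c) ≡ replicate r c
reverse-replicate zero    c = refl
reverse-replicate (suc r) c = begin
  reverse (c ∷ replicate r c)        ≡⟨ unfold-reverse c (replicate r c) ⟩
  reverse (replicate r c) ++ c ∷ []  ≡⟨ cong (_++ c ∷ []) (reverse-replicate r c) ⟩
  replicate r c ++ c ∷ []            ≡⟨ replicate-∷ʳ r c ⟩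
  replicate (suc r) c                ∎
  where open ≡-Reasoning

replicate≢++other∷ : ∀ c r w w′ → replicate r c ≢ w ++ other c ∷ w′
replicate≢++other∷ c (suc r) []      w′ eq = self≢other c (proj₁ (∷-injective eq))
replicate≢++other∷ c (suc r) (x ∷ w) w′ eq = replicate≢++other∷ c r w w′ (proj₂ (∷-injective eq))

at-++ˡ : ∀ p xs ys → p < length xs → at (xs ++ ys) p ≡ at xs p
at-++ˡ zero    (x ∷ xs) ys _         = refl
at-++ˡ (suc p) (x ∷ xs) ys (s≤s p<) = at-++ˡ p xs ys p<

at-++ʳ : ∀ q xs ys → at (xs ++ ys) (length xs + q) ≡ at ys q
at-++ʳ q []       ys = refl
at-++ʳ q (x ∷ xs) ys = at-++ʳ q xs ys

at⇒<length : ∀ xs p {c} → at xs p ≡ just c → p < length xs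
at⇒<length (x ∷ xs) zero    _  = s≤s z≤n
at⇒<length (x ∷ xs) (suc p) eq = s≤s (at⇒<length xs p eq)

at-replicate : ∀ r c q {c′} → at (replicate r c) q ≡ just c′ → c′ ≡ c
at-replicate (suc r) c zero    refl = refl
at-replicate (suc r) c (suc q) eq   = at-replicate r c q eq

at-replicate-< : ∀ r c q → q < r → at (replicate r c) q ≡ just c
at-replicate-< (suc r) c zero    _         = refl
at-replicate-< (suc r) c (suc q) (s≤s q<) = at-replicate-< r c q q<

count-take-suc : ∀ c s p {x} → at s p ≡ just x → count c (take (suc p) s) ≡ δ c x + count c (take p s)
count-take-suc c (y ∷ s) zero    refl = begin
  count c (y ∷ [])     ≡⟨ count-∷ c y [] ⟩
  δ c y + count c []   ∎
  where open ≡-Reasoning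
count-take-suc c (y ∷ s) (suc p) {x} eq = begin
  count c (y ∷ take (suc p) s)              ≡⟨ count-∷ c y _ ⟩
  δ c y + count c (take (suc p) s)          ≡⟨ cong (δ c y +_) (count-take-suc c s p eq) ⟩
  δ c y + (δ c x + count c (take p s))      ≡⟨ x∙yz≈y∙xz (δ c y) (δ c x) _ ⟩
  δ c x + (δ c y + count c (take p s))      ≡⟨ cong (δ c x +_) (count-∷ c y _) ⟨
  δ c x + count c (y ∷ take p s)            ∎
  where open ≡-Reasoning

count-take-suc≤ : ∀ c s t → count c (take t s) ≤ count c (take (suc t) s)
count-take-suc≤ c []      t       = ≤-reflexive (cong (count c) (trans (take-[] t) (sym (take-[] (suc t)))))
count-take-suc≤ c (x ∷ s) zero    = subst (count c [] ≤_) (sym (count-∷ c x [])) (m≤n+m _ (δ c x))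
count-take-suc≤ c (x ∷ s) (suc t) =
  subst₂ _≤_ (sym (count-∷ c x _)) (sym (count-∷ c x _)) (+-monoʳ-≤ (δ c x) (count-take-suc≤ c s t))

count-take-suc≤suc : ∀ c s t → count c (take (suc t) s) ≤ suc (count c (take t s))
count-take-suc≤suc c []      t       = subst (_≤ suc (count c (take t []))) (sym (count-[] c)) z≤n
count-take-suc≤suc c (x ∷ s) zero    =
  subst₂ _≤_ (sym (count-∷ c x [])) (cong suc (sym (count-[] c)))
    (subst (_≤ 1) (sym (trans (cong (δ c x +_) (count-[] c)) (+-identityʳ _))) (δ≤1 c x))
count-take-suc≤suc c (x ∷ s) (suc t) = begin
  count c (x ∷ take (suc t) s)         ≡⟨ count-∷ c x _ ⟩
  δ c x + count c (take (suc t) s)     ≤⟨ +-monoʳ-≤ (δ c x) (count-take-suc≤suc c s t) ⟩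
  δ c x + suc (count c (take t s))     ≡⟨ +-suc (δ c x) _ ⟩
  suc (δ c x + count c (take t s))     ≡⟨ cong suc (count-∷ c x _) ⟨
  suc (count c (x ∷ take t s))         ∎
  where open ≤-Reasoning

count-take≤count : ∀ c s t → count c (take t s) ≤ count c s
count-take≤count c s t = begin
  count c (take t s)                       ≤⟨ m≤m+n _ _ ⟩
  count c (take t s) + count c (drop t s)  ≡⟨ count-++ c (take t s) (drop t s) ⟨
  count c (take t s ++ drop t s)           ≡⟨ cong (count c) (take++drop≡id t s) ⟩
  count c s                                ∎
  where open ≤-Reasoning

count-take≤ : ∀ c s t → count c (take t s) ≤ t
count-take≤ c s t = begin
  count c (take t s)   ≤⟨ count≤length c (take t s) ⟩
  length (take t s)    ≡⟨ length-take t s ⟩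
  t ⊓ length s         ≤⟨ m⊓n≤m t (length s) ⟩
  t                    ∎
  where open ≤-Reasoning

count≤count-take+rest : ∀ c s t → count c s ≤ count c (take t s) + (length s ∸ t)
count≤count-take+rest c s t = begin
  count c s                                 ≡⟨ cong (count c) (take++drop≡id t s) ⟨
  count c (take t s ++ drop t s)            ≡⟨ count-++ c (take t s) (drop t s) ⟩
  count c (take t s) + count c (drop t s)   ≤⟨ +-monoʳ-≤ _ (count≤length c (drop t s)) ⟩
  count c (take t s) + length (drop t s)    ≡⟨ cong (count c (take t s) +_) (length-drop t s) ⟩
  count c (take t s) + (length s ∸ t)       ∎
  where open ≤-Reasoning

count-take<count : ∀ s p c → at s p ≡ just c → count c (take p s) < count c s
count-take<count (y ∷ s) zero    c refl = subst₂ _<_ (sym (count-[] c)) (sym (count-self∷ c s)) (s≤s z≤n)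
count-take<count (y ∷ s) (suc p) c eq   =
  subst₂ _<_ (sym (count-∷ c y _)) (sym (count-∷ c y _)) (+-monoʳ-< (δ c y) (count-take<count s p c eq))

at-++-count≡0 : ∀ xs ys p c → at (xs ++ ys) p ≡ just c → count c ys ≡ 0 → p < length xs
at-++-count≡0 xs ys p c eq ys≡0 with position (length xs) p
... | inside p<  = p<
... | beyond q   = ⊥-elim (n≮0 (subst (count c (take q ys) <_) ys≡0
                     (count-take<count ys q c (trans (sym (at-++ʳ q xs ys)) eq))))

countE+countN-take : ∀ s t → t ≤ length s → countE (take t s) + countN (take t s) ≡ t
countE+countN-take s t t≤ = trans (countE+countN≡length (take t s)) (trans (length-take t s) (m≤n⇒m⊓n≡m t≤))

at-length-++ : ∀ xs ys → at (xs ++ ys) (length xs) ≡ at ys 0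
at-length-++ []       ys = refl
at-length-++ (x ∷ xs) ys = at-length-++ xs ys

-- Inserting a step into a framed border

leading : Step → Path → ℕ
leading N = leadingN
leading E = leadingE

trailing : Step → Path → ℕ
trailing c s = leading c (reverse s)

dropTrailing : Step → Path → Path
dropTrailing c s = reverse (drop (trailing c s) (reverse s))

start : Step → Path → ℕ
start c W = count c W ∸ trailing c W

-- By definition addRow a U = insertAt E a U and addCol b L = insertAt N b L.
insertAt : Step → ℕ → Path → Path
insertAt c a W = dropTrailing c W ++ replicate (a ∸ start c W) c ++ (other c ∷ replicate (count c W ∸ a) c)

-- The upper border of a polyomino is frame E u = N u E, its lower border frame N d = E d N.
frame : Step → Path → Path
frame c z = other c ∷ z ++ c ∷ []

leading-replicate-++ : ∀ c k w → leading c (replicate k c ++ w) ≡ k + leading c w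
leading-replicate-++ N zero    w = refl
leading-replicate-++ E zero    w = refl
leading-replicate-++ N (suc k) w = cong suc (leading-replicate-++ N k w)
leading-replicate-++ E (suc k) w = cong suc (leading-replicate-++ E k w)

leading-++-other : ∀ c w → leading c (w ++ other c ∷ []) ≡ leading c w
leading-++-other N []      = refl
leading-++-other E []      = refl
leading-++-other N (N ∷ w) = cong suc (leading-++-other N w)
leading-++-other E (E ∷ w) = cong suc (leading-++-other E w)
leading-++-other N (E ∷ w) = refl
leading-++-other E (N ∷ w) = refl

split-leading : ∀ c w → w ≡ replicate (leading c w) c ++ drop (leading c w) w
split-leading N []      = refl
split-leading E []      = refl
split-leading N (N ∷ w) = cong (N ∷_) (split-leading N w)
split-leading E (E ∷ w) = cong (E ∷_) (split-leading E w)
split-leading N (E ∷ w) = refl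
split-leading E (N ∷ w) = refl

split-trailing : ∀ c s → s ≡ dropTrailing c s ++ replicate (trailing c s) c
split-trailing c s = begin
  s                                                        ≡⟨ reverse-involutive s ⟨
  reverse (reverse s)                                      ≡⟨ cong reverse (split-leading c (reverse s)) ⟩
  reverse (replicate (trailing c s) c ++ drop (trailing c s) (reverse s))
                                                           ≡⟨ reverse-++ (replicate (trailing c s) c) _ ⟩
  dropTrailing c s ++ reverse (replicate (trailing c s) c) ≡⟨ cong (dropTrailing c s ++_) (reverse-replicate (trailing c s) c) ⟩
  dropTrailing c s ++ replicate (trailing c s) c           ∎
  where open ≡-Reasoning

count-split-trailing : ∀ c s → count c s ≡ count c (dropTrailing c s) + trailing c s
count-split-trailing c s = begin
  count c s                                                 ≡⟨ cong (count c) (split-trailing c s) ⟩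
  count c (dropTrailing c s ++ replicate (trailing c s) c)  ≡⟨ count-++ c (dropTrailing c s) _ ⟩
  count c (dropTrailing c s) + count c (replicate (trailing c s) c)
                                                            ≡⟨ cong (count c (dropTrailing c s) +_) (count-replicate-self c _) ⟩
  count c (dropTrailing c s) + trailing c s                 ∎
  where open ≡-Reasoning

reverse-++-replicate : ∀ c (v : Path) k → reverse (v ++ replicate k c) ≡ replicate k c ++ reverse v
reverse-++-replicate c v k = trans (reverse-++ v (replicate k c)) (cong (_++ reverse v) (reverse-replicate k c))

trailing-++-replicate : ∀ c v k → trailing c (v ++ replicate k c) ≡ k + trailing c v
trailing-++-replicate c v k = trans (cong (leading c) (reverse-++-replicate c v k)) (leading-replicate-++ c k (reverse v))

dropTrailing-++-replicate : ∀ c v k → dropTrailing c (v ++ replicate k c) ≡ dropTrailing c v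
dropTrailing-++-replicate c v k = cong reverse (begin
  drop (trailing c (v ++ replicate k c)) (reverse (v ++ replicate k c))
    ≡⟨ cong₂ drop (trailing-++-replicate c v k) (reverse-++-replicate c v k) ⟩
  drop (k + trailing c v) (replicate k c ++ reverse v)
    ≡⟨ drop-replicate-++ k (trailing c v) c (reverse v) ⟩
  drop (trailing c v) (reverse v) ∎)
  where open ≡-Reasoning

trailing-other∷ : ∀ c v → trailing c (other c ∷ v) ≡ trailing c v
trailing-other∷ c v = trans (cong (leading c) (unfold-reverse (other c) v)) (leading-++-other c (reverse v))

count-frame : ∀ c z → count c (frame c z) ≡ suc (count c z)
count-frame c z = trans (count-other∷ c _) (trans (count-∷ʳ c z c) (cong (_+ count c z) (δ-self c)))

start-frame : ∀ c z → start c (frame c z) ≡ count c z ∸ trailing c z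
start-frame c z = cong₂ _∸_ (count-frame c z) (begin
  trailing c (other c ∷ z ++ replicate 1 c)  ≡⟨ cong (trailing c) (++-assoc (other c ∷ []) z _) ⟨
  trailing c ((other c ∷ z) ++ replicate 1 c) ≡⟨ trailing-++-replicate c (other c ∷ z) 1 ⟩
  suc (trailing c (other c ∷ z))              ≡⟨ cong suc (trailing-other∷ c z) ⟩
  suc (trailing c z)                          ∎)
  where open ≡-Reasoning

count-++-replicate-self : ∀ c X k → count c (X ++ replicate k c) ≡ count c X + k
count-++-replicate-self c X k = trans (count-++ c X _) (cong (count c X +_) (count-replicate-self c k))

split-at-count : ∀ c z a → count c z ∸ trailing c z ≤ a → a ≤ count c z →
  Σ Path λ x → Σ ℕ λ r → (z ≡ x ++ replicate r c) × (count c x ≡ a)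
split-at-count c z a start≤a a≤count = D ++ replicate α c , T ∸ α , z≡ , count-x
  where
  D = dropTrailing c z
  T = trailing c z
  K = count c D
  count-z : count c z ≡ K + T
  count-z = count-split-trailing c z
  K≤a : K ≤ a
  K≤a = subst (_≤ a) (trans (cong (_∸ T) count-z) (m+n∸n≡m K T)) start≤a
  α = a ∸ K
  K+α≡a : K + α ≡ a
  K+α≡a = m+[n∸m]≡n K≤a
  α≤T : α ≤ T
  α≤T = +-cancelˡ-≤ K α T (subst₂ _≤_ (sym K+α≡a) count-z a≤count)
  z≡ : z ≡ (D ++ replicate α c) ++ replicate (T ∸ α) c
  z≡ = begin
    z                                               ≡⟨ split-trailing c z ⟩
    D ++ replicate T c                              ≡⟨ cong (λ n → D ++ replicate n c) (m+[n∸m]≡n α≤T) ⟨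
    D ++ replicate (α + (T ∸ α)) c                  ≡⟨ cong (D ++_) (replicate-+ α (T ∸ α) c) ⟩
    D ++ replicate α c ++ replicate (T ∸ α) c       ≡⟨ ++-assoc D _ _ ⟨
    (D ++ replicate α c) ++ replicate (T ∸ α) c     ∎
    where open ≡-Reasoning
  count-x : count c (D ++ replicate α c) ≡ a
  count-x = trans (count-++ c D _) (trans (cong (K +_) (count-replicate-self c α)) K+α≡a)

insertAt-≡ : ∀ c a W {D j k} → dropTrailing c W ≡ D → a ∸ start c W ≡ j → count c W ∸ a ≡ k →
  insertAt c a W ≡ D ++ replicate j c ++ other c ∷ replicate k c
insertAt-≡ c a W refl refl refl = refl

insertAt-++-replicate : ∀ c X k → insertAt c (count c X) (X ++ replicate k c) ≡ X ++ other c ∷ replicate k c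
insertAt-++-replicate c X k = begin
  insertAt c (count c X) (X ++ replicate k c)
    ≡⟨ insertAt-≡ c (count c X) W (dropTrailing-++-replicate c X k) a∸start≡j count-W∸a≡k ⟩
  D ++ replicate j c ++ other c ∷ replicate k c    ≡⟨ ++-assoc D _ _ ⟨
  (D ++ replicate j c) ++ other c ∷ replicate k c  ≡⟨ cong (_++ other c ∷ replicate k c) (split-trailing c X) ⟨
  X ++ other c ∷ replicate k c                     ∎
  where
  open ≡-Reasoning
  W = X ++ replicate k c
  D = dropTrailing c X
  j = trailing c X
  K = count c D
  count-X : count c X ≡ K + j
  count-X = count-split-trailing c X
  count-W : count c W ≡ count c X + k
  count-W = count-++-replicate-self c X k
  start-W : start c W ≡ K
  start-W = begin
    count c W ∸ trailing c W      ≡⟨ cong₂ _∸_ (trans count-W (cong (_+ k) count-X)) (trailing-++-replicate c X k) ⟩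
    (K + j + k) ∸ (k + j)         ≡⟨ cong (_∸ (k + j)) (trans (+-assoc K j k) (cong (K +_) (+-comm j k))) ⟩
    (K + (k + j)) ∸ (k + j)       ≡⟨ m+n∸n≡m K (k + j) ⟩
    K                             ∎
  a∸start≡j : count c X ∸ start c W ≡ j
  a∸start≡j = trans (cong₂ _∸_ count-X start-W) (m+n∸m≡n K j)
  count-W∸a≡k : count c W ∸ count c X ≡ k
  count-W∸a≡k = trans (cong (_∸ count c X) count-W) (m+n∸m≡n (count c X) k)

start-++-replicate≤ : ∀ c X k → start c (X ++ replicate k c) ≤ count c X
start-++-replicate≤ c X k = begin
  count c (X ++ replicate k c) ∸ trailing c (X ++ replicate k c)
    ≡⟨ cong₂ _∸_ (count-++-replicate-self c X k) (trailing-++-replicate c X k) ⟩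
  (count c X + k) ∸ (k + trailing c X)                           ≤⟨ ∸-monoʳ-≤ (count c X + k) (m≤m+n k _) ⟩
  (count c X + k) ∸ k                                            ≡⟨ m+n∸n≡m (count c X) k ⟩
  count c X                                                      ∎
  where open ≤-Reasoning

frame-++-replicate : ∀ c x r → frame c (x ++ replicate r c) ≡ (other c ∷ x) ++ replicate (suc r) c
frame-++-replicate c x r = cong (other c ∷_) (trans (++-assoc x _ _) (cong (x ++_) (replicate-∷ʳ r c)))

frame-++-other∷ : ∀ c x r → (other c ∷ x) ++ other c ∷ replicate (suc r) c ≡ frame c (x ++ other c ∷ replicate r c)
frame-++-other∷ c x r = cong (other c ∷_) (sym (trans (++-assoc x _ _) (cong (λ w → x ++ other c ∷ w) (replicate-∷ʳ r c))))

record ValidInsertion (c : Step) (a : ℕ) (W W′ : Path) : Set where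
  field
    start≤ : start c W ≤ a
    <count : a < count c W
    inserted : insertAt c a W ≡ W′

insertion-frame : ∀ c x r →
  ValidInsertion c (count c x) (frame c (x ++ replicate r c)) (frame c (x ++ other c ∷ replicate r c))
insertion-frame c x r rewrite frame-++-replicate c x r = record
  { start≤   = subst (start c (X ++ replicate (suc r) c) ≤_) count-X≡ (start-++-replicate≤ c X (suc r))
  ; <count   = subst₂ _<_ count-X≡ (sym (count-++-replicate-self c X (suc r))) (m<m+n (count c X) (s≤s z≤n))
  ; inserted = trans (cong (λ a → insertAt c a (X ++ replicate (suc r) c)) (sym count-X≡))
                     (trans (insertAt-++-replicate c X (suc r)) (frame-++-other∷ c x r))
  }
  where
  X = other c ∷ x
  count-X≡ : count c X ≡ count c x
  count-X≡ = count-other∷ c x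

split-frame-at : ∀ c z a → start c (frame c z) ≤ a → a < count c (frame c z) →
  Σ Path λ x → Σ ℕ λ r → (z ≡ x ++ replicate r c) × (count c x ≡ a)
split-frame-at c z a start≤a a<count =
  split-at-count c z a (subst (_≤ a) (start-frame c z) start≤a) (≤-pred (subst (a <_) (count-frame c z) a<count))

-- Prefix dominance and nested triples

infix 4 _≤ᴱ_

_≤ᴱ_ : Path → Path → Set
u ≤ᴱ m = ∀ t → countE (take t u) ≤ countE (take t m)

countE-take-∷ʳN : ∀ t m → countE (take t (m ++ N ∷ [])) ≡ countE (take t m)
countE-take-∷ʳN zero    m       = refl
countE-take-∷ʳN (suc t) []      = cong countE (take-[] t)
countE-take-∷ʳN (suc t) (N ∷ m) = countE-take-∷ʳN t m
countE-take-∷ʳN (suc t) (E ∷ m) = cong suc (countE-take-∷ʳN t m)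

countE-take-insertN : ∀ t x y → countE (take t (x ++ N ∷ y)) ≤ countE (take t (x ++ y))
countE-take-insertN zero    x       y = ≤-refl
countE-take-insertN (suc t) []      y = count-take-suc≤ E y t
countE-take-insertN (suc t) (N ∷ x) y = countE-take-insertN t x y
countE-take-insertN (suc t) (E ∷ x) y = s≤s (countE-take-insertN t x y)

countE-take-insertE : ∀ t x y → countE (take t (x ++ y)) ≤ countE (take t (x ++ E ∷ y))
countE-take-insertE zero    x       y = ≤-refl
countE-take-insertE (suc t) []      y = count-take-suc≤suc E y t
countE-take-insertE (suc t) (N ∷ x) y = countE-take-insertE t x y
countE-take-insertE (suc t) (E ∷ x) y = s≤s (countE-take-insertE t x y)

countE-take-beyond : ∀ s t → length s ≤ t → countE (take t s) ≡ countE s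
countE-take-beyond s t len≤ = cong countE (take-all t s len≤)

≤ᴱ-total : ∀ {u m} → u ≤ᴱ m → countE u ≤ countE m
≤ᴱ-total {u} {m} u≤m = subst₂ _≤_
  (countE-take-beyond u _ (m≤m+n _ _)) (countE-take-beyond m _ (m≤n+m (length m) (length u)))
  (u≤m (length u + length m))

≤ᴱ-++ : ∀ xs ys zs → length xs ≡ length ys → xs ≤ᴱ ys → xs ++ zs ≤ᴱ ys ++ zs
≤ᴱ-++ xs ys zs len xs≤ys t with position (length xs) t
... | inside t< = subst₂ _≤_ (cong countE (sym (take-++ˡ t xs zs (<⇒≤ t<))))
                              (cong countE (sym (take-++ˡ t ys zs (subst (t ≤_) len (<⇒≤ t<)))))
                              (xs≤ys t)
... | beyond q  = subst₂ _≤_ (sym (countE-take-++ʳ xs))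
                              (sym (trans (cong (λ n → countE (take (n + q) (ys ++ zs))) len) (countE-take-++ʳ ys)))
                              (+-monoˡ-≤ _ (≤ᴱ-total xs≤ys))
  where
  countE-take-++ʳ : ∀ (ws : Path) → countE (take (length ws + q) (ws ++ zs)) ≡ countE ws + countE (take q zs)
  countE-take-++ʳ ws = trans (cong countE (take-++ʳ q ws zs)) (count-++ E ws _)

countE-take-length-++ : ∀ (xs ys : Path) q → countE (take (length xs + q) (xs ++ ys)) ≡ countE xs + countE (take q ys)
countE-take-length-++ xs ys q = trans (cong countE (take-++ʳ q xs ys)) (count-++ E xs _)

countE-take-++ˡ : ∀ t (xs ys : Path) → t ≤ length xs → countE (take t (xs ++ ys)) ≡ countE (take t xs)
countE-take-++ˡ t xs ys t≤ = cong countE (take-++ˡ t xs ys t≤)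

≤ᴱ-++⁻¹ : ∀ u m zs zs′ → length u ≡ length m → countE u ≤ countE m → u ++ zs ≤ᴱ m ++ zs′ → u ≤ᴱ m
≤ᴱ-++⁻¹ u m zs zs′ len u≤m u++≤m++ t with position (length u) t
... | inside t< = subst₂ _≤_ (countE-take-++ˡ t u zs (<⇒≤ t<)) (countE-take-++ˡ t m zs′ (subst (t ≤_) len (<⇒≤ t<)))
                              (u++≤m++ t)
... | beyond q  = subst₂ _≤_ (sym (countE-take-beyond u _ (m≤m+n _ q)))
                              (sym (countE-take-beyond m _ (subst (_≤ length u + q) len (m≤m+n _ q))))
                              u≤m

-- Beyond x no dominance is needed: ending in the run E^r keeps the prefix counts as low as the totals of m allow.
≤ᴱ-deleteN : ∀ x r m → length m ≡ length x + r → countE m ≡ countE x + r →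
             x ++ N ∷ replicate r E ≤ᴱ m ++ N ∷ [] → x ++ replicate r E ≤ᴱ m
≤ᴱ-deleteN x r m len cnt ≤m t with position (length x) t
... | inside t< = subst₂ _≤_ (trans (countE-take-++ˡ t x _ (<⇒≤ t<)) (sym (countE-take-++ˡ t x _ (<⇒≤ t<))))
                              (countE-take-∷ʳN t m)
                              (≤m t)
... | beyond q  = begin
  countE (take (length x + q) (x ++ replicate r E))  ≡⟨ countE-take-length-++ x _ q ⟩
  countE x + countE (take q (replicate r E))         ≤⟨ +-monoʳ-≤ (countE x) run≤ ⟩
  countE x + q ⊓ r                                   ≤⟨ +-cancelʳ-≤ (r ∸ q) _ _ total ⟩
  R                                                  ∎
  where
  open ≤-Reasoning
  R = countE (take (length x + q) m)
  run≤ : countE (take q (replicate r E)) ≤ q ⊓ r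
  run≤ = ⊓-glb (count-take≤ E _ q)
               (≤-trans (count-take≤count E _ q) (≤-reflexive (count-replicate-self E r)))
  total : countE x + q ⊓ r + (r ∸ q) ≤ R + (r ∸ q)
  total = begin
    countE x + q ⊓ r + (r ∸ q)                ≡⟨ +-assoc (countE x) _ _ ⟩
    countE x + (q ⊓ r + (r ∸ q))              ≡⟨ cong (countE x +_) (m⊓n+n∸m≡n q r) ⟩
    countE x + r                              ≡⟨ cnt ⟨
    countE m                                  ≤⟨ count≤count-take+rest E m (length x + q) ⟩
    R + (length m ∸ (length x + q))           ≡⟨ cong (λ n → R + (n ∸ (length x + q))) len ⟩
    R + ((length x + r) ∸ (length x + q))     ≡⟨ cong (R +_) ([m+n]∸[m+o]≡n∸o (length x) r q) ⟩
    R + (r ∸ q)                               ∎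

≤ᴱ-deleteE : ∀ m x r → countE m ≡ countE x → length x ≤ length m →
             m ++ E ∷ [] ≤ᴱ x ++ E ∷ replicate r N → m ≤ᴱ x ++ replicate r N
≤ᴱ-deleteE m x r cnt len ≤x t with position (length x) t
... | inside t< = subst₂ _≤_ (countE-take-++ˡ t m _ (≤-trans (<⇒≤ t<) len))
                              (trans (countE-take-++ˡ t x _ (<⇒≤ t<)) (sym (countE-take-++ˡ t x _ (<⇒≤ t<))))
                              (≤x t)
... | beyond q  = begin
  countE (take (length x + q) m)                     ≤⟨ count-take≤count E m (length x + q) ⟩
  countE m                                           ≡⟨ cnt ⟩
  countE x                                           ≤⟨ m≤m+n _ _ ⟩
  countE x + countE (take q (replicate r N))         ≡⟨ countE-take-length-++ x _ q ⟨
  countE (take (length x + q) (x ++ replicate r N))  ∎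
  where open ≤-Reasoning

≰ᴱ-∷ʳ : ∀ u m → length u ≡ length m → countE (u ++ N ∷ []) ≡ countE (m ++ E ∷ []) →
        ¬ (u ++ N ∷ [] ≤ᴱ m ++ E ∷ [])
≰ᴱ-∷ʳ u m len cnt u≤m = 1+n≰n (begin
  suc (countE m)                              ≡⟨ count-∷ʳ E m E ⟨
  countE (m ++ E ∷ [])                        ≡⟨ cnt ⟨
  countE (u ++ N ∷ [])                        ≡⟨ count-∷ʳ E u N ⟩
  countE u                                    ≡⟨ cong countE (take-length-++ u _) ⟨
  countE (take (length u) (u ++ N ∷ []))      ≤⟨ u≤m (length u) ⟩
  countE (take (length u) (m ++ E ∷ []))      ≡⟨ cong (λ n → countE (take n (m ++ E ∷ []))) len ⟩
  countE (take (length m) (m ++ E ∷ []))      ≡⟨ cong countE (take-length-++ m _) ⟩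
  countE m                                    ∎)
  where open ≤-Reasoning

length-∷ʳ : ∀ (xs : Path) x → length (xs ++ x ∷ []) ≡ suc (length xs)
length-∷ʳ xs x = trans (length-++ xs) (+-comm (length xs) 1)

hstep : Path → ℕ → Path → Path → Triple
hstep x r m d = triple (x ++ N ∷ replicate r E) (m ++ N ∷ []) (d ++ N ∷ [])

vstep : Path → Path → Path → ℕ → Triple
vstep u m x r = triple (u ++ E ∷ []) (m ++ E ∷ []) (x ++ E ∷ replicate r N)

record Nested (t : Triple) : Set where
  open Triple t
  field
    length-up   : length up ≡ length mid
    length-down : length down ≡ length mid
    countE-up   : countE up ≡ countE mid
    countE-down : countE mid ≡ countE down
    up≤ᴱmid     : up ≤ᴱ mid
    mid≤ᴱdown   : mid ≤ᴱ down

nested-hstep : ∀ x r m d → Nested (triple (x ++ replicate r E) m d) →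
               Nested (hstep x r m d)
nested-hstep x r m d n = record
  { length-up   = trans (length-++-sucʳ x N _) (trans (cong suc length-up) (sym (length-∷ʳ m N)))
  ; length-down = trans (length-∷ʳ d N) (trans (cong suc length-down) (sym (length-∷ʳ m N)))
  ; countE-up   = trans (count-insert E x N _) (trans countE-up (sym (count-∷ʳ E m N)))
  ; countE-down = trans (count-∷ʳ E m N) (trans countE-down (sym (count-∷ʳ E d N)))
  ; up≤ᴱmid     = λ t → ≤-trans (countE-take-insertN t x _)
                          (≤-trans (up≤ᴱmid t) (≤-reflexive (sym (countE-take-∷ʳN t m))))
  ; mid≤ᴱdown   = λ t → subst₂ _≤_ (sym (countE-take-∷ʳN t m)) (sym (countE-take-∷ʳN t d)) (mid≤ᴱdown t)
  }
  where open Nested n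

nested-vstep : ∀ u m x r → Nested (triple u m (x ++ replicate r N)) →
               Nested (vstep u m x r)
nested-vstep u m x r n = record
  { length-up   = trans (length-∷ʳ u E) (trans (cong suc length-up) (sym (length-∷ʳ m E)))
  ; length-down = length-d′
  ; countE-up   = trans (count-∷ʳ E u E) (trans (cong suc countE-up) (sym (count-∷ʳ E m E)))
  ; countE-down = countE-d′
  ; up≤ᴱmid     = ≤ᴱ-++ u m (E ∷ []) length-up up≤ᴱmid
  ; mid≤ᴱdown   = m′≤d′
  }
  where
  open Nested n
  d′ = x ++ E ∷ replicate r N
  length-d′ : length d′ ≡ length (m ++ E ∷ [])
  length-d′ = trans (length-++-sucʳ x E _) (trans (cong suc length-down) (sym (length-∷ʳ m E)))
  countE-d′ : countE (m ++ E ∷ []) ≡ countE d′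
  countE-d′ = trans (count-∷ʳ E m E) (trans (cong suc countE-down) (sym (count-insert E x E _)))
  m′≤d′ : m ++ E ∷ [] ≤ᴱ d′
  m′≤d′ t with position (suc (length m)) t
  ... | inside t<sm = begin
    countE (take t (m ++ E ∷ []))        ≡⟨ countE-take-++ˡ t m _ (s≤s⁻¹ t<sm) ⟩
    countE (take t m)                    ≤⟨ mid≤ᴱdown t ⟩
    countE (take t (x ++ replicate r N)) ≤⟨ countE-take-insertE t x _ ⟩
    countE (take t d′)                   ∎
    where open ≤-Reasoning
  ... | beyond q    = begin
    countE (take (suc (length m) + q) (m ++ E ∷ []))  ≤⟨ count-take≤count E (m ++ E ∷ []) (suc (length m) + q) ⟩
    countE (m ++ E ∷ [])                              ≡⟨ countE-d′ ⟩
    countE d′                                         ≡⟨ countE-take-beyond d′ _ d′≤ ⟨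
    countE (take (suc (length m) + q) d′)             ∎
    where
    open ≤-Reasoning
    d′≤ : length d′ ≤ suc (length m) + q
    d′≤ = ≤-trans (≤-reflexive (trans length-d′ (length-∷ʳ m E))) (m≤m+n _ q)

nested-hstep⁻¹ : ∀ x r m d → Nested (hstep x r m d) →
                 Nested (triple (x ++ replicate r E) m d)
nested-hstep⁻¹ x r m d n = record
  { length-up   = length-u₀
  ; length-down = suc-injective (trans (sym (length-∷ʳ d N)) (trans length-down (length-∷ʳ m N)))
  ; countE-up   = countE-u₀
  ; countE-down = trans (sym (count-∷ʳ E m N)) (trans countE-down (count-∷ʳ E d N))
  ; up≤ᴱmid     = ≤ᴱ-deleteN x r m length-m countE-m up≤ᴱmid
  ; mid≤ᴱdown   = λ t → subst₂ _≤_ (countE-take-∷ʳN t m) (countE-take-∷ʳN t d) (mid≤ᴱdown t)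
  }
  where
  open Nested n
  length-u₀ : length (x ++ replicate r E) ≡ length m
  length-u₀ = suc-injective (trans (sym (length-++-sucʳ x N _)) (trans length-up (length-∷ʳ m N)))
  countE-u₀ : countE (x ++ replicate r E) ≡ countE m
  countE-u₀ = trans (sym (count-insert E x N _)) (trans countE-up (count-∷ʳ E m N))
  length-m : length m ≡ length x + r
  length-m = trans (sym length-u₀) (trans (length-++ x) (cong (length x +_) (length-replicate r)))
  countE-m : countE m ≡ countE x + r
  countE-m = trans (sym countE-u₀) (count-++-replicate-self E x r)

nested-vstep⁻¹ : ∀ u m x r → Nested (vstep u m x r) →
                 Nested (triple u m (x ++ replicate r N))
nested-vstep⁻¹ u m x r n = record
  { length-up   = length-u₀
  ; length-down = length-d₀
  ; countE-up   = countE-u₀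
  ; countE-down = countE-d₀
  ; up≤ᴱmid     = ≤ᴱ-++⁻¹ u m (E ∷ []) (E ∷ []) length-u₀ (≤-reflexive countE-u₀) up≤ᴱmid
  ; mid≤ᴱdown   = ≤ᴱ-deleteE m x r (trans countE-d₀ (count-++-replicate-other E x r))
                    (subst (length x ≤_) length-d₀ (length-++-≤ˡ x)) mid≤ᴱdown
  }
  where
  open Nested n
  length-u₀ : length u ≡ length m
  length-u₀ = suc-injective (trans (sym (length-∷ʳ u E)) (trans length-up (length-∷ʳ m E)))
  length-d₀ : length (x ++ replicate r N) ≡ length m
  length-d₀ = suc-injective (trans (sym (length-++-sucʳ x E _)) (trans length-down (length-∷ʳ m E)))
  countE-u₀ : countE u ≡ countE m
  countE-u₀ = suc-injective (trans (sym (count-∷ʳ E u E)) (trans countE-up (count-∷ʳ E m E)))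
  countE-d₀ : countE m ≡ countE (x ++ replicate r N)
  countE-d₀ = suc-injective (trans (sym (count-∷ʳ E m E)) (trans countE-down (count-insert E x E _)))

-- Nested triples are the non-intersecting triples

vertex : Point → Path → ℕ → Point
vertex (x , y) s t = x + countE (take t s) , y + countN (take t s)

vertex-zero : ∀ x y s → vertex (x , y) s 0 ≡ (x , y)
vertex-zero x y s = cong₂ _,_ (+-identityʳ x) (+-identityʳ y)

vertex-N∷ : ∀ x y s t → vertex (x , y) (N ∷ s) (suc t) ≡ vertex (x , suc y) s t
vertex-N∷ x y s t = cong (x + countE (take t s) ,_) (+-suc y _)

vertex-E∷ : ∀ x y s t → vertex (x , y) (E ∷ s) (suc t) ≡ vertex (suc x , y) s t
vertex-E∷ x y s t = cong (_, y + countN (take t s)) (+-suc x _)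

∈-vertices⁻¹ : ∀ x y s {pt} → pt ∈ vertices (x , y) s → Σ ℕ λ t → t ≤ length s × pt ≡ vertex (x , y) s t
∈-vertices⁻¹ x y []      (here eq) = 0 , z≤n , trans eq (sym (vertex-zero x y []))
∈-vertices⁻¹ x y (N ∷ s) (here eq) = 0 , z≤n , trans eq (sym (vertex-zero x y (N ∷ s)))
∈-vertices⁻¹ x y (E ∷ s) (here eq) = 0 , z≤n , trans eq (sym (vertex-zero x y (E ∷ s)))
∈-vertices⁻¹ x y (N ∷ s) (there p) =
  let (t , t≤ , eq) = ∈-vertices⁻¹ x (suc y) s p in suc t , s≤s t≤ , trans eq (sym (vertex-N∷ x y s t))
∈-vertices⁻¹ x y (E ∷ s) (there p) =
  let (t , t≤ , eq) = ∈-vertices⁻¹ (suc x) y s p in suc t , s≤s t≤ , trans eq (sym (vertex-E∷ x y s t))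

vertex-∈ : ∀ x y s t → t ≤ length s → vertex (x , y) s t ∈ vertices (x , y) s
vertex-∈ x y []      zero    _        = here (vertex-zero x y [])
vertex-∈ x y (N ∷ s) zero    _        = here (vertex-zero x y (N ∷ s))
vertex-∈ x y (E ∷ s) zero    _        = here (vertex-zero x y (E ∷ s))
vertex-∈ x y (N ∷ s) (suc t) (s≤s t≤) =
  there (subst (_∈ vertices (x , suc y) s) (sym (vertex-N∷ x y s t)) (vertex-∈ x (suc y) s t t≤))
vertex-∈ x y (E ∷ s) (suc t) (s≤s t≤) =
  there (subst (_∈ vertices (suc x , y) s) (sym (vertex-E∷ x y s t)) (vertex-∈ (suc x) y s t t≤))

vertex-antidiagonal : ∀ x y s t → t ≤ length s → proj₁ (vertex (x , y) s t) + proj₂ (vertex (x , y) s t) ≡ x + y + t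
vertex-antidiagonal x y s t t≤ = begin
  (x + a) + (y + n)   ≡⟨ interchange x a y n ⟩
  x + y + (a + n)     ≡⟨ cong (x + y +_) (countE+countN-take s t t≤) ⟩
  x + y + t           ∎
  where
  open ≡-Reasoning
  a = countE (take t s)
  n = countN (take t s)

-- A common vertex lies on the same antidiagonal of both paths, hence has the same index on both.
disjoint-if-left : ∀ x₁ y₁ x₂ y₂ s₁ s₂ → x₁ + y₁ ≡ x₂ + y₂ →
  (∀ t → x₁ + countE (take t s₁) < x₂ + countE (take t s₂)) →
  Disjoint (vertices (x₁ , y₁) s₁) (vertices (x₂ , y₂) s₂)
disjoint-if-left x₁ y₁ x₂ y₂ s₁ s₂ diag left pt p₁ p₂
  with ∈-vertices⁻¹ x₁ y₁ s₁ p₁ | ∈-vertices⁻¹ x₂ y₂ s₂ p₂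
... | t₁ , t₁≤ , refl | t₂ , t₂≤ , eq =
  <-irrefl (trans (cong proj₁ eq) (cong (λ t → x₂ + countE (take t s₂)) (sym t₁≡t₂))) (left t₁)
  where
  t₁≡t₂ : t₁ ≡ t₂
  t₁≡t₂ = +-cancelˡ-≡ (x₁ + y₁) t₁ t₂ (begin
    x₁ + y₁ + t₁                    ≡⟨ vertex-antidiagonal x₁ y₁ s₁ t₁ t₁≤ ⟨
    proj₁ pt + proj₂ pt             ≡⟨ cong₂ _+_ (cong proj₁ eq) (cong proj₂ eq) ⟩
    proj₁ (vertex (x₂ , y₂) s₂ t₂) + proj₂ (vertex (x₂ , y₂) s₂ t₂)
                                    ≡⟨ vertex-antidiagonal x₂ y₂ s₂ t₂ t₂≤ ⟩
    x₂ + y₂ + t₂                    ≡⟨ cong (_+ t₂) diag ⟨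
    x₁ + y₁ + t₂                    ∎)
    where open ≡-Reasoning

at-defined : ∀ s t → t < length s → Σ Step λ c → at s t ≡ just c
at-defined (c ∷ s) zero    _         = c , refl
at-defined (c ∷ s) (suc t) (s≤s t<) = at-defined s t t<

-- Two paths started at (x, y+1) and (x+1, y) can only trade places through a common vertex.
disjoint-step : ∀ x y s₁ s₂ → length s₁ ≡ length s₂ →
  Disjoint (vertices (x , suc y) s₁) (vertices (suc x , y) s₂) →
  ∀ t → countE (take t s₁) ≤ countE (take t s₂) → countE (take (suc t) s₁) ≤ countE (take (suc t) s₂)
disjoint-step x y s₁ s₂ len disj t a≤b with position (length s₁) t
... | beyond q  = subst₂ _≤_ (sym (countE-take-suc-beyond s₁ (m≤m+n _ q)))
                              (sym (countE-take-suc-beyond s₂ (subst (_≤ length s₁ + q) len (m≤m+n _ q))))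
                              a≤b
  where
  countE-take-suc-beyond : ∀ s {t} → length s ≤ t → countE (take (suc t) s) ≡ countE (take t s)
  countE-take-suc-beyond s {t} len≤ =
    trans (countE-take-beyond s (suc t) (≤-trans len≤ (n≤1+n t))) (sym (countE-take-beyond s t len≤))
... | inside t< = step (at-defined s₁ t t<) (at-defined s₂ t (subst (t <_) len t<))
  where
  a = countE (take t s₁)
  b = countE (take t s₂)
  step : (Σ Step λ c → at s₁ t ≡ just c) → (Σ Step λ c → at s₂ t ≡ just c) →
         countE (take (suc t) s₁) ≤ countE (take (suc t) s₂)
  step (N , at₁) (c₂ , at₂) = subst₂ _≤_ (sym (count-take-suc E s₁ t at₁)) (sym (count-take-suc E s₂ t at₂))
                                 (≤-trans a≤b (m≤n+m b (δ E c₂)))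
  step (E , at₁) (E , at₂) = subst₂ _≤_ (sym (count-take-suc E s₁ t at₁)) (sym (count-take-suc E s₂ t at₂))
                                 (s≤s a≤b)
  step (E , at₁) (N , at₂) with m≤n⇒m<n∨m≡n a≤b
  ... | inj₁ a<b = subst₂ _≤_ (sym (count-take-suc E s₁ t at₁)) (sym (count-take-suc E s₂ t at₂)) a<b
  ... | inj₂ a≡b = ⊥-elim (disj _ (vertex-∈ x (suc y) s₁ (suc t) t<)
                                   (subst (_∈ vertices (suc x , y) s₂) (sym meet)
                                          (vertex-∈ (suc x) y s₂ (suc t) (subst (suc t ≤_) len t<))))
    where
    n₁≡n₂ : countN (take t s₁) ≡ countN (take t s₂)
    n₁≡n₂ = +-cancelˡ-≡ a _ _ (begin
      a + countN (take t s₁)   ≡⟨ countE+countN-take s₁ t (<⇒≤ t<) ⟩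
      t                        ≡⟨ countE+countN-take s₂ t (<⇒≤ (subst (t <_) len t<)) ⟨
      b + countN (take t s₂)   ≡⟨ cong (_+ countN (take t s₂)) a≡b ⟨
      a + countN (take t s₂)   ∎)
      where open ≡-Reasoning
    meet : vertex (x , suc y) s₁ (suc t) ≡ vertex (suc x , y) s₂ (suc t)
    meet = cong₂ _,_
      (begin
        x + countE (take (suc t) s₁)   ≡⟨ cong (x +_) (count-take-suc E s₁ t at₁) ⟩
        x + suc a                      ≡⟨ +-suc x a ⟩
        suc x + a                      ≡⟨ cong (suc x +_) (trans a≡b (sym (count-take-suc E s₂ t at₂))) ⟩
        suc x + countE (take (suc t) s₂) ∎)
      (begin
        suc y + countN (take (suc t) s₁) ≡⟨ cong (suc y +_) (trans (count-take-suc N s₁ t at₁) n₁≡n₂) ⟩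
        suc y + countN (take t s₂)       ≡⟨ +-suc y _ ⟨
        y + suc (countN (take t s₂))     ≡⟨ cong (y +_) (count-take-suc N s₂ t at₂) ⟨
        y + countN (take (suc t) s₂)     ∎)
      where open ≡-Reasoning

≤ᴱ-if-disjoint : ∀ x y s₁ s₂ → length s₁ ≡ length s₂ →
  Disjoint (vertices (x , suc y) s₁) (vertices (suc x , y) s₂) → s₁ ≤ᴱ s₂
≤ᴱ-if-disjoint x y s₁ s₂ len disj zero    = z≤n
≤ᴱ-if-disjoint x y s₁ s₂ len disj (suc t) =
  disjoint-step x y s₁ s₂ len disj t (≤ᴱ-if-disjoint x y s₁ s₂ len disj t)

nested⇒NITriple : ∀ {t} → Nested t → NITriple (suc (length (Triple.mid t))) t
nested⇒NITriple {triple u m d} n = record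
  { len-u   = cong suc length-up
  ; len-m   = refl
  ; len-d   = cong suc length-down
  ; E-um    = countE-up
  ; E-md    = countE-down
  ; disj-um = disjoint-if-left 0 2 1 1 u m refl (λ t → s≤s (up≤ᴱmid t))
  ; disj-ud = disjoint-if-left 0 2 2 0 u d refl (λ t → s≤s (≤-trans (≤-trans (up≤ᴱmid t) (mid≤ᴱdown t)) (n≤1+n _)))
  ; disj-md = disjoint-if-left 1 1 2 0 m d refl (λ t → s≤s (s≤s (mid≤ᴱdown t)))
  }
  where open Nested n

NITriple⇒nested : ∀ {n t} → NITriple n t → Nested t
NITriple⇒nested {n} {triple u m d} ni = record
  { length-up   = length-u
  ; length-down = length-d
  ; countE-up   = E-um
  ; countE-down = E-md
  ; up≤ᴱmid     = ≤ᴱ-if-disjoint 0 1 u m length-u disj-um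
  ; mid≤ᴱdown   = ≤ᴱ-if-disjoint 1 0 m d (sym length-d) disj-md
  }
  where
  open NITriple ni
  length-u : length u ≡ length m
  length-u = suc-injective (trans len-u (sym len-m))
  length-d : length d ≡ length m
  length-d = suc-injective (trans len-d (sym len-m))

-- The triple of a Baxter slicing

dropLast-∷ʳ : ∀ (z : Path) x → dropLast (z ++ x ∷ []) ≡ z
dropLast-∷ʳ []           x = refl
dropLast-∷ʳ (y ∷ [])     x = refl
dropLast-∷ʳ (y ∷ y′ ∷ z) x = cong (y ∷_) (dropLast-∷ʳ (y′ ∷ z) x)

inner-frame : ∀ c z → inner (frame c z) ≡ z
inner-frame c z = dropLast-∷ʳ z c

Framed : Step → Path → Set
Framed c W = W ≡ frame c (inner W)

framed : ∀ {c W z} → W ≡ frame c z → Framed c W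
framed {c} {W} {z} W≡ = trans W≡ (cong (frame c) (sym (trans (cong inner W≡) (inner-frame c z))))

inner-framed-∷ʳ : ∀ {c W} → Framed c W → inner (W ++ c ∷ []) ≡ inner W ++ c ∷ []
inner-framed-∷ʳ {c} {W} W≡ = trans (cong (λ V → inner (V ++ c ∷ [])) W≡) (inner-frame c (inner W ++ c ∷ []))

record Insertion (c : Step) (a : ℕ) (W : Path) : Set where
  field
    prefix       : Path
    run          : ℕ
    count-prefix : count c prefix ≡ a
    inner-before : inner W ≡ prefix ++ replicate run c
    after        : insertAt c a W ≡ frame c (prefix ++ other c ∷ replicate run c)

insertion : ∀ c a {W} → Framed c W → start c W ≤ a → a < count c W → Insertion c a W
insertion c a {W} W≡ start≤a a<count
  with split-frame-at c (inner W) a (subst (λ V → start c V ≤ a) W≡ start≤a) (subst (λ V → a < count c V) W≡ a<count)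
... | x , r , z≡ , refl = record
  { prefix       = x
  ; run          = r
  ; count-prefix = refl
  ; inner-before = z≡
  ; after        = begin
      insertAt c (count c x) W                              ≡⟨ cong (insertAt c (count c x)) (trans W≡ (cong (frame c) z≡)) ⟩
      insertAt c (count c x) (frame c (x ++ replicate r c)) ≡⟨ ValidInsertion.inserted (insertion-frame c x r) ⟩
      frame c (x ++ other c ∷ replicate r c)                ∎
  }
  where open ≡-Reasoning

inner-after : ∀ {c a W} (ins : Insertion c a W) →
              inner (insertAt c a W) ≡ Insertion.prefix ins ++ other c ∷ replicate (Insertion.run ins) c
inner-after {c} ins = trans (cong inner (Insertion.after ins)) (inner-frame c _)

borders-framed : ∀ {U L bs} → BaxterSlicing U L bs → Framed E U × Framed N L
borders-framed one = refl , refl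
borders-framed (hblock a s tl al) =
  let (U≡ , L≡) = borders-framed s in framed (Insertion.after (insertion E a U≡ tl al)) , framed (cong (_++ N ∷ []) L≡)
borders-framed (vblock b s rl bl) =
  let (U≡ , L≡) = borders-framed s in framed (cong (_++ E ∷ []) U≡) , framed (Insertion.after (insertion N b L≡ rl bl))

record RowView {U L bs} (s : BaxterSlicing U L bs) (a : ℕ) (tl : topStart U ≤ a) (al : a < countE U) : Set where
  field
    prefix        : Path
    run           : ℕ
    countE-prefix : countE prefix ≡ a
    Φ-before      : Φ s ≡ triple (prefix ++ replicate run E) (midPath s) (inner L)
    Φ-after       : Φ (hblock a s tl al) ≡ hstep prefix run (midPath s) (inner L)

rowView : ∀ {U L bs} (s : BaxterSlicing U L bs) a tl al → RowView s a tl al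
rowView s a tl al = record
  { prefix        = prefix
  ; run           = run
  ; countE-prefix = count-prefix
  ; Φ-before      = cong (λ u → triple u (midPath s) _) inner-before
  ; Φ-after       = cong₂ (λ u d → triple u (midPath s ++ N ∷ []) d)
                          (inner-after ins) (inner-framed-∷ʳ (proj₂ (borders-framed s)))
  }
  where
  ins = insertion E a (proj₁ (borders-framed s)) tl al
  open Insertion ins

record ColumnView {U L bs} (s : BaxterSlicing U L bs) (b : ℕ) (rl : rightStart L ≤ b) (bl : b < countN L) : Set where
  field
    prefix        : Path
    run           : ℕ
    countN-prefix : countN prefix ≡ b
    Φ-before      : Φ s ≡ triple (inner U) (midPath s) (prefix ++ replicate run N)
    Φ-after       : Φ (vblock b s rl bl) ≡ vstep (inner U) (midPath s) prefix run

columnView : ∀ {U L bs} (s : BaxterSlicing U L bs) b rl bl → ColumnView s b rl bl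
columnView s b rl bl = record
  { prefix        = prefix
  ; run           = run
  ; countN-prefix = count-prefix
  ; Φ-before      = cong (triple _ (midPath s)) inner-before
  ; Φ-after       = cong₂ (λ u d → triple u (midPath s ++ E ∷ []) d)
                          (inner-framed-∷ʳ (proj₁ (borders-framed s))) (inner-after ins)
  }
  where
  ins = insertion N b (proj₂ (borders-framed s)) rl bl
  open Insertion ins

nested-[] : Nested (triple [] [] [])
nested-[] = record
  { length-up = refl ; length-down = refl ; countE-up = refl ; countE-down = refl
  ; up≤ᴱmid = λ _ → ≤-refl ; mid≤ᴱdown = λ _ → ≤-refl }

Φ-nested : ∀ {U L bs} (s : BaxterSlicing U L bs) → Nested (Φ s)
Φ-nested one = nested-[]
Φ-nested (hblock a s tl al) = subst Nested (sym Φ-after) (nested-hstep prefix run _ _ (subst Nested Φ-before (Φ-nested s)))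
  where open RowView (rowView s a tl al)
Φ-nested (vblock b s rl bl) = subst Nested (sym Φ-after) (nested-vstep _ _ prefix run (subst Nested Φ-before (Φ-nested s)))
  where open ColumnView (columnView s b rl bl)

length-blocks : ∀ {U L bs} (s : BaxterSlicing U L bs) → length bs ≡ suc (length (midPath s))
length-blocks one                = refl
length-blocks (hblock a s tl al) = cong suc (trans (length-blocks s) (sym (length-∷ʳ (midPath s) N)))
length-blocks (vblock b s rl bl) = cong suc (trans (length-blocks s) (sym (length-∷ʳ (midPath s) E)))

countE-up≡suc-mid : ∀ {U L bs} (s : BaxterSlicing U L bs) → countE U ≡ suc (countE (midPath s))
countE-up≡suc-mid {U} s = begin
  countE U                    ≡⟨ cong countE (proj₁ (borders-framed s)) ⟩
  countE (frame E (inner U))  ≡⟨ count-frame E (inner U) ⟩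
  suc (countE (inner U))      ≡⟨ cong suc (Nested.countE-up (Φ-nested s)) ⟩
  suc (countE (midPath s))    ∎
  where open ≡-Reasoning

countE-up≡countE-down : ∀ {U L bs} → BaxterSlicing U L bs → countE U ≡ countE L
countE-up≡countE-down {U} {L} s = begin
  countE U                    ≡⟨ countE-up≡suc-mid s ⟩
  suc (countE (midPath s))    ≡⟨ cong suc (Nested.countE-down (Φ-nested s)) ⟩
  suc (countE (inner L))      ≡⟨ cong suc (count-∷ʳ E (inner L) N) ⟨
  countE (frame N (inner L))  ≡⟨ cong countE (proj₂ (borders-framed s)) ⟨
  countE L                    ∎
  where open ≡-Reasoning

RightEdgesWithin : Path → List Block → Set
RightEdgesWithin L bs = ∀ b → b ∈ bs → Block.kind b ≡ hor → Block.x b + Block.w b ≤ countE L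

right-edges-within : ∀ {U L bs} → BaxterSlicing U L bs → RightEdgesWithin L bs
right-edges-within one b (here refl) ()
right-edges-within (hblock {U} {L} a s tl al) b (here refl) _ = begin
  a + (countE U ∸ a)    ≡⟨ m+[n∸m]≡n (<⇒≤ al) ⟩
  countE U              ≡⟨ countE-up≡countE-down s ⟩
  countE L              ≡⟨ count-∷ʳ E L N ⟨
  countE (L ++ N ∷ [])  ∎
  where open ≤-Reasoning
right-edges-within (hblock {L = L} a s tl al) b (there b∈) isHor =
  ≤-trans (right-edges-within s b b∈ isHor) (≤-reflexive (sym (count-∷ʳ E L N)))
right-edges-within (vblock b s rl bl) b′ (here refl) ()
right-edges-within (vblock {U} {L} b s rl bl) b′ (there b′∈) isHor = begin
  Block.x b′ + Block.w b′  ≤⟨ right-edges-within s b′ b′∈ isHor ⟩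
  countE L                 ≡⟨ countE-up≡countE-down s ⟨
  countE U                 ≤⟨ n≤1+n _ ⟩
  suc (countE U)           ≡⟨ count-∷ʳ E U E ⟨
  countE (U ++ E ∷ [])     ≡⟨ countE-up≡countE-down (vblock b s rl bl) ⟩
  countE (addCol b L)      ∎
  where open ≤-Reasoning

-- Schröder conditions

IsNth-++ˡ : ∀ c xs ys {i p} → IsNth c xs i p → IsNth c (xs ++ ys) i p
IsNth-++ˡ c xs ys {i} {p} (at≡ , count≡) =
  trans (at-++ˡ p xs ys p<) at≡ , trans (cong (count c) (take-++ˡ p xs ys (<⇒≤ p<))) count≡
  where p< = at⇒<length xs p at≡

IsNth-++ˡ⁻¹ : ∀ c xs ys {i p} → p < length xs → IsNth c (xs ++ ys) i p → IsNth c xs i p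
IsNth-++ˡ⁻¹ c xs ys {i} {p} p< (at≡ , count≡) =
  trans (sym (at-++ˡ p xs ys p<)) at≡ , trans (cong (count c) (sym (take-++ˡ p xs ys (<⇒≤ p<)))) count≡

LastEBefore-++ˡ : ∀ xs ys {q e} → q ≤ length xs → LastEBefore xs q e → LastEBefore (xs ++ ys) q e
LastEBefore-++ˡ xs ys {q} {e} q≤ (at≡ , e<q , between) =
  trans (at-++ˡ e xs ys (<-≤-trans e<q q≤)) at≡ , e<q ,
  λ e′ e< <q → trans (at-++ˡ e′ xs ys (<-≤-trans <q q≤)) (between e′ e< <q)

LastEBefore-++ˡ⁻¹ : ∀ xs ys {q e} → q ≤ length xs → LastEBefore (xs ++ ys) q e → LastEBefore xs q e
LastEBefore-++ˡ⁻¹ xs ys {q} {e} q≤ (at≡ , e<q , between) =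
  trans (sym (at-++ˡ e xs ys (<-≤-trans e<q q≤))) at≡ , e<q ,
  λ e′ e< <q → trans (sym (at-++ˡ e′ xs ys (<-≤-trans <q q≤))) (between e′ e< <q)

runE-++ˡ : ∀ xs ys p → p < length xs → runE (xs ++ ys) p ≡ runE xs p
runE-++ˡ xs ys p p< = cong (λ w → leadingE (reverse w)) (take-++ˡ (suc p) xs ys p<)

countE-take-++-≡ : ∀ x y z {p} → p ≤ length x → countE (take p (x ++ y)) ≡ countE (take p (x ++ z))
countE-take-++-≡ x y z {p} p≤ = trans (countE-take-++ˡ p x y p≤) (sym (countE-take-++ˡ p x z p≤))

runE-++-≡ : ∀ x y z {p} → p < length x → runE (x ++ y) p ≡ runE (x ++ z) p
runE-++-≡ x y z {p} p< = trans (runE-++ˡ x y p p<) (sym (runE-++ˡ x z p p<))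

data NthPosition (c : Step) (x : Path) (i p : ℕ) : Set where
  old : p < length x → IsNth c x i p → NthPosition c x i p
  new : p ≡ length x → i ≡ count c x → NthPosition c x i p

nthPosition : ∀ c x r {i p} → IsNth c (x ++ c ∷ replicate r (other c)) i p → NthPosition c x i p
nthPosition c x r {i} {p} isNth@(at≡ , count≡) with position (length x) p
... | inside p<      = old p< (IsNth-++ˡ⁻¹ c x _ p< isNth)
... | beyond zero    = new (+-identityʳ (length x)) (begin
  i                                                              ≡⟨ count≡ ⟨
  count c (take (length x + 0) (x ++ c ∷ replicate r (other c)))
    ≡⟨ cong (λ n → count c (take n (x ++ c ∷ replicate r (other c)))) (+-identityʳ (length x)) ⟩
  count c (take (length x) (x ++ c ∷ replicate r (other c)))      ≡⟨ cong (count c) (take-length-++ x _) ⟩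
  count c x                                                       ∎)
  where open ≡-Reasoning
... | beyond (suc q) = ⊥-elim (self≢other c (at-replicate r (other c) q (trans (sym (at-++ʳ (suc q) x _)) at≡)))

IsNth-last : ∀ c x y → IsNth c (x ++ c ∷ y) (count c x) (length x)
IsNth-last c x y = at-length-++ x (c ∷ y) , cong (count c) (take-length-++ x _)

-- The Schröder condition of hstep x r m d′ at the new N steps of u and m, where a = countE x.
SchroderAtNewRow : Path → Path → ℕ → Set
SchroderAtNewRow m d a =
  ∀ j pe pd → LastEBefore (m ++ N ∷ []) (length m) pe → IsNth E (m ++ N ∷ []) j pe → IsNth E d j pd →
  countE m ≤ runE d pd + a

schroder-hstep⁻¹ : ∀ x r m d → countN x ≡ countN m → SchroderCond (hstep x r m d) →
  SchroderAtNewRow m (d ++ N ∷ []) (countE x) × SchroderCond (triple (x ++ replicate r E) m d)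
schroder-hstep⁻¹ x r m d cn sc = atNewRow , before
  where
  before : SchroderCond (triple (x ++ replicate r E) m d)
  before i j pu pm pe pd hu hm leb he hd = subst₂ _≤_
    (countE-take-++ˡ pm m _ (<⇒≤ pm<))
    (cong₂ _+_ (runE-++ˡ d _ pd (at⇒<length d pd (proj₁ hd))) (countE-take-++-≡ x _ _ (<⇒≤ pu<)))
    (sc i j pu pm pe pd (IsNth-++ˡ N x _ (IsNth-++ˡ⁻¹ N x _ pu< hu)) (IsNth-++ˡ N m _ hm)
        (LastEBefore-++ˡ m _ (<⇒≤ pm<) leb) (IsNth-++ˡ E m _ he) (IsNth-++ˡ E d _ hd))
    where
    pu< = at-++-count≡0 x (replicate r E) pu N (proj₁ hu) (count-replicate-other N r)
    pm< = at⇒<length m pm (proj₁ hm)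
  atNewRow : SchroderAtNewRow m (d ++ N ∷ []) (countE x)
  atNewRow j pe pd leb he hd = subst₂ _≤_
    (cong countE (take-length-++ m _))
    (cong (runE (d ++ N ∷ []) pd +_) (cong countE (take-length-++ x _)))
    (sc (countN x) j (length x) (length m) pe pd (IsNth-last N x _)
        (subst (λ i → IsNth N (m ++ N ∷ []) i (length m)) (sym cn) (IsNth-last N m [])) leb he hd)

schroder-hstep : ∀ x r m d → countN x ≡ countN m →
  SchroderAtNewRow m (d ++ N ∷ []) (countE x) → SchroderCond (triple (x ++ replicate r E) m d) →
  SchroderCond (hstep x r m d)
schroder-hstep x r m d cn atNewRow sc i j pu pm pe pd hu hm leb he hd
  with nthPosition N x r hu | nthPosition N m 0 hm
... | old pu< hu′ | old pm< hm′ = subst₂ _≤_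
  (sym (countE-take-++ˡ pm m _ (<⇒≤ pm<)))
  (sym (cong₂ _+_ (runE-++ˡ d _ pd pd<) (countE-take-++-≡ x _ _ (<⇒≤ pu<))))
  (sc i j pu pm pe pd (IsNth-++ˡ N x _ hu′) hm′ (LastEBefore-++ˡ⁻¹ m _ (<⇒≤ pm<) leb)
      (IsNth-++ˡ⁻¹ E m _ (<-trans (proj₁ (proj₂ leb)) pm<) he) (IsNth-++ˡ⁻¹ E d _ pd< hd))
  where pd< = at-++-count≡0 d (N ∷ []) pd E (proj₁ hd) refl
... | old _ (at≡ , i≡) | new _ i≡′ =
  ⊥-elim (<-irrefl (trans i≡ (trans i≡′ (sym cn))) (count-take<count x pu N at≡))
... | new _ i≡ | old _ (at≡ , i≡′) =
  ⊥-elim (<-irrefl (trans i≡′ (trans i≡ cn)) (count-take<count m pm N at≡))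
... | new refl _ | new refl _ = subst₂ _≤_
  (sym (cong countE (take-length-++ m _)))
  (sym (cong (runE (d ++ N ∷ []) pd +_) (cong countE (take-length-++ x _))))
  (atNewRow j pe pd leb he hd)

schroder-vstep⁻¹ : ∀ u m x r → SchroderCond (vstep u m x r) → SchroderCond (triple u m (x ++ replicate r N))
schroder-vstep⁻¹ u m x r sc i j pu pm pe pd hu hm leb he hd = subst₂ _≤_
  (countE-take-++ˡ pm m _ (<⇒≤ pm<))
  (cong₂ _+_ (runE-++-≡ x _ _ pd<) (countE-take-++ˡ pu u _ (<⇒≤ (at⇒<length u pu (proj₁ hu)))))
  (sc i j pu pm pe pd (IsNth-++ˡ N u _ hu) (IsNth-++ˡ N m _ hm) (LastEBefore-++ˡ m _ (<⇒≤ pm<) leb)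
      (IsNth-++ˡ E m _ he) (IsNth-++ˡ E x _ (IsNth-++ˡ⁻¹ E x _ pd< hd)))
  where
  pm< = at⇒<length m pm (proj₁ hm)
  pd< = at-++-count≡0 x (replicate r N) pd E (proj₁ hd) (count-replicate-other E r)

schroder-vstep : ∀ u m x r → countE x ≡ countE m →
  SchroderCond (triple u m (x ++ replicate r N)) → SchroderCond (vstep u m x r)
schroder-vstep u m x r ce sc i j pu pm pe pd hu hm leb he hd with nthPosition E x r hd
... | new _ j≡ = ⊥-elim (<-irrefl (trans (proj₂ he′) (trans j≡ ce)) (count-take<count m pe E (proj₁ he′)))
  where
  pe< = <-trans (proj₁ (proj₂ leb)) (at-++-count≡0 m (E ∷ []) pm N (proj₁ hm) refl)
  he′ = IsNth-++ˡ⁻¹ E m _ pe< he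
... | old pd< hd′ = subst₂ _≤_
  (sym (countE-take-++ˡ pm m _ (<⇒≤ pm<)))
  (sym (cong₂ _+_ (runE-++-≡ x _ _ pd<) (countE-take-++ˡ pu u _ (<⇒≤ pu<))))
  (sc i j pu pm pe pd (IsNth-++ˡ⁻¹ N u _ pu< hu) (IsNth-++ˡ⁻¹ N m _ pm< hm) (LastEBefore-++ˡ⁻¹ m _ (<⇒≤ pm<) leb)
      (IsNth-++ˡ⁻¹ E m _ (<-trans (proj₁ (proj₂ leb)) pm<) he) (IsNth-++ˡ E x _ hd′))
  where
  pu< = at-++-count≡0 u (E ∷ []) pu N (proj₁ hu) refl
  pm< = at-++-count≡0 m (E ∷ []) pm N (proj₁ hm) refl

leadingE-++ : ∀ w v → leadingE w ≤ leadingE (w ++ v)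
leadingE-++ []      v = z≤n
leadingE-++ (N ∷ w) v = z≤n
leadingE-++ (E ∷ w) v = s≤s (leadingE-++ w v)

leadingE-∷ʳ : ∀ w x → leadingE (w ++ x ∷ []) ≡ leadingE w ⊎ leadingE w ≡ length w
leadingE-∷ʳ []      x = inj₂ refl
leadingE-∷ʳ (N ∷ w) x = inj₁ refl
leadingE-∷ʳ (E ∷ w) x with leadingE-∷ʳ w x
... | inj₁ eq = inj₁ (cong suc eq)
... | inj₂ eq = inj₂ (cong suc eq)

runE-∷ : ∀ s p c → runE s p ≤ runE (c ∷ s) (suc p)
runE-∷ s p c = subst (runE s p ≤_) (cong leadingE (sym (unfold-reverse c (take (suc p) s))))
                     (leadingE-++ (reverse (take (suc p) s)) (c ∷ []))

countE-take-LastEBefore : ∀ s {q e} → LastEBefore s q e → countE (take q s) ≡ suc (countE (take e s))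
countE-take-LastEBefore s {q} {e} (at≡ , e<q , between) = begin
  countE (take q s)                      ≡⟨ cong (λ k → countE (take k s)) (m+[n∸m]≡n e<q) ⟨
  countE (take (suc e + (q ∸ suc e)) s)  ≡⟨ only-N (q ∸ suc e) (≤-reflexive (m+[n∸m]≡n e<q)) ⟩
  countE (take (suc e) s)                ≡⟨ count-take-suc E s e at≡ ⟩
  suc (countE (take e s))                ∎
  where
  open ≡-Reasoning
  only-N : ∀ n → suc e + n ≤ q → countE (take (suc e + n) s) ≡ countE (take (suc e) s)
  only-N zero    _ = cong (λ k → countE (take k s)) (+-identityʳ (suc e))
  only-N (suc n) ≤q = begin
    countE (take (suc e + suc n) s)   ≡⟨ cong (λ k → countE (take k s)) (+-suc (suc e) n) ⟩
    countE (take (suc (suc e + n)) s) ≡⟨ count-take-suc E s (suc e + n) (between (suc e + n) (s≤s (m≤m+n e n)) <q) ⟩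
    countE (take (suc e + n) s)       ≡⟨ only-N n (<⇒≤ <q) ⟩
    countE (take (suc e) s)           ∎
    where
    <q : suc e + n < q
    <q = subst (_≤ q) (+-suc (suc e) n) ≤q

lastE-position : ∀ y r zs → LastEBefore ((y ++ E ∷ replicate r N) ++ zs) (length (y ++ E ∷ replicate r N)) (length y) ×
                      IsNth E ((y ++ E ∷ replicate r N) ++ zs) (countE y) (length y)
lastE-position y r zs = LastEBefore-++ˡ m zs ≤-refl (proj₁ isLast , y< , onlyN) , IsNth-++ˡ E m zs isLast
  where
  m = y ++ E ∷ replicate r N
  isLast : IsNth E m (countE y) (length y)
  isLast = IsNth-last E y (replicate r N)
  length-m : length m ≡ length y + suc r
  length-m = trans (length-++ y) (cong (λ k → length y + suc k) (length-replicate r))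
  y< : length y < length m
  y< = subst (length y <_) (sym length-m) (m<m+n (length y) (s≤s z≤n))
  onlyN : ∀ e′ → length y < e′ → e′ < length m → at m e′ ≡ just N
  onlyN e′ y<e′ e′< with position (length y) e′
  ... | inside e′<     = ⊥-elim (<-asym y<e′ e′<)
  ... | beyond zero    = ⊥-elim (<-irrefl (sym (+-identityʳ _)) y<e′)
  ... | beyond (suc q) = trans (at-++ʳ (suc q) y _)
          (at-replicate-< r N q (s≤s⁻¹ (+-cancelˡ-< (length y) (suc q) (suc r) (subst (length y + suc q <_) length-m e′<))))

lastE-exists : ∀ m j → countE m ≡ suc j →
  Σ ℕ λ pe → LastEBefore (m ++ N ∷ []) (length m) pe × IsNth E (m ++ N ∷ []) j pe
lastE-exists m j K≡ with split-last E m (λ K≡0 → 1+n≢0 (trans (sym K≡) K≡0))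
... | y , r , refl =
  length y , proj₁ (lastE-position y r (N ∷ [])) ,
  subst (λ i → IsNth E _ i (length y)) countE-y (proj₂ (lastE-position y r (N ∷ [])))
  where
  countE-y : countE y ≡ j
  countE-y = suc-injective (trans (sym (trans (count-insert E y E _) (cong suc (count-++-replicate-other E y r)))) K≡)

SchroderBlock : Path → Block → Set
SchroderBlock L b = Block.kind b ≡ hor → ∀ p → at L p ≡ just E →
  suc (countE (take p L)) ≡ Block.x b + Block.w b → Block.w b ≤ suc (runE L p)

newRow : ℕ → ℕ → ℕ → Block
newRow a y K = block hor a y (suc K ∸ a) 1

atNewRow⇒SchroderBlock : ∀ m d a y → a ≤ countE m → SchroderAtNewRow m d a →
  SchroderBlock (frame N d) (newRow a y (countE m))
atNewRow⇒SchroderBlock m d a y a≤K atNewRow refl zero _ edge = begin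
  suc K ∸ a                      ≤⟨ m∸n≤m (suc K) a ⟩
  suc K                          ≡⟨ trans edge (m+[n∸m]≡n (m≤n⇒m≤1+n a≤K)) ⟨
  1                              ≤⟨ s≤s z≤n ⟩
  suc (runE (frame N d) 0)       ∎
  where
  open ≤-Reasoning
  K = countE m
atNewRow⇒SchroderBlock m d a y a≤K atNewRow refl (suc p) at≡ edge = begin
  suc K ∸ a                       ≡⟨ +-∸-assoc 1 a≤K ⟩
  suc (K ∸ a)                     ≤⟨ s≤s (m≤n+o⇒m∸n≤o K a (subst (K ≤_) (+-comm _ a) K≤)) ⟩
  suc (runE d p)                  ≡⟨ cong suc (runE-++ˡ d _ p p<) ⟨
  suc (runE (d ++ N ∷ []) p)      ≤⟨ s≤s (runE-∷ (d ++ N ∷ []) p E) ⟩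
  suc (runE (frame N d) (suc p))  ∎
  where
  open ≤-Reasoning
  K = countE m
  p< : p < length d
  p< = at-++-count≡0 d (N ∷ []) p E at≡ refl
  j = countE (take p d)
  K≡ : suc j ≡ K
  K≡ = suc-injective (trans (cong (λ w → suc (suc (countE w))) (sym (take-++ˡ p d (N ∷ []) (<⇒≤ p<))))
                            (trans edge (m+[n∸m]≡n (m≤n⇒m≤1+n a≤K))))
  K≤ : K ≤ runE d p + a
  K≤ = let (pe , lastE , isNth) = lastE-exists m j (sym K≡) in
       atNewRow j pe p lastE isNth (trans (sym (at-++ˡ p d (N ∷ []) p<)) at≡ , refl)

SchroderBlock⇒atNewRow : ∀ m d a y → a ≤ countE m →
  SchroderBlock (frame N d) (newRow a y (countE m)) → SchroderAtNewRow m d a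
SchroderBlock⇒atNewRow m d a y a≤K isSchroder j pe pd lastE isNth (at≡ , j≡) = K≤
  where
  K = countE m
  K≡ : K ≡ suc j
  K≡ = trans (cong countE (sym (take-length-++ m (N ∷ []))))
             (trans (countE-take-LastEBefore _ lastE) (cong suc (proj₂ isNth)))
  pd< : pd < length d
  pd< = at⇒<length d pd at≡
  edge : suc (countE (take (suc pd) (frame N d))) ≡ a + (suc K ∸ a)
  edge = begin
    suc (suc (countE (take pd (d ++ N ∷ []))))
      ≡⟨ cong (λ n → suc (suc n)) (trans (countE-take-++ˡ pd d _ (<⇒≤ pd<)) j≡) ⟩
    suc (suc j)                                 ≡⟨ cong suc K≡ ⟨
    suc K                                       ≡⟨ m+[n∸m]≡n (m≤n⇒m≤1+n a≤K) ⟨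
    a + (suc K ∸ a)                             ∎
    where open ≡-Reasoning
  bound : suc K ∸ a ≤ suc (runE (frame N d) (suc pd))
  bound = isSchroder refl (suc pd) (trans (at-++ˡ pd d _ pd<) at≡) edge
  w = reverse (take (suc pd) d)
  runE-frame : runE (frame N d) (suc pd) ≡ leadingE (w ++ E ∷ [])
  runE-frame = cong leadingE (trans (unfold-reverse E (take (suc pd) (d ++ N ∷ [])))
                                    (cong (λ z → reverse z ++ E ∷ []) (take-++ˡ (suc pd) d (N ∷ []) pd<)))
  K≤ : K ≤ runE d pd + a
  K≤ with leadingE-∷ʳ w E
  ... | inj₁ same = begin
    K                     ≤⟨ m≤n+m∸n K a ⟩
    a + (K ∸ a)
      ≤⟨ +-monoʳ-≤ a (s≤s⁻¹ (subst₂ _≤_ (+-∸-assoc 1 a≤K) (cong suc (trans runE-frame same)) bound)) ⟩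
    a + runE d pd         ≡⟨ +-comm a _ ⟩
    runE d pd + a         ∎
    where open ≤-Reasoning
  ... | inj₂ full = begin
    K                     ≡⟨ K≡ ⟩
    suc j                 ≤⟨ s≤s (subst (_≤ pd) j≡ (count-take≤ E d pd)) ⟩
    suc pd                ≡⟨ trans (length-reverse (take (suc pd) d)) (trans (length-take (suc pd) d) (m≤n⇒m⊓n≡m pd<)) ⟨
    length w              ≡⟨ full ⟨
    runE d pd             ≤⟨ m≤m+n _ a ⟩
    runE d pd + a         ∎
    where open ≤-Reasoning

SchroderBlock-at-++ : ∀ D Y Y′ b p → p < length D → SchroderBlock (D ++ Y) b →
  Block.kind b ≡ hor → at (D ++ Y′) p ≡ just E →
  suc (countE (take p (D ++ Y′))) ≡ Block.x b + Block.w b → Block.w b ≤ suc (runE (D ++ Y′) p)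
SchroderBlock-at-++ D Y Y′ b p p< isSchroder isHor at≡ edge =
  subst (Block.w b ≤_) (cong suc (runE-++-≡ D Y Y′ p<))
    (isSchroder isHor p (trans (at-++ˡ p D Y p<) (trans (sym (at-++ˡ p D Y′ p<)) at≡))
                        (trans (cong suc (countE-take-++-≡ D Y Y′ (<⇒≤ p<))) edge))

-- Only the part of L left of the right edge of a row matters for its condition.
schroderSlicing-++ : ∀ D Y Y′ bs → countE Y ≡ 0 → RightEdgesWithin D bs →
  SchroderSlicing (D ++ Y) bs ⇔ SchroderSlicing (D ++ Y′) bs
schroderSlicing-++ D Y Y′ bs Y≡0 within = mk⇔ to from
  where
  to : SchroderSlicing (D ++ Y) bs → SchroderSlicing (D ++ Y′) bs
  to ss b b∈ isHor p at≡ edge with position (length D) p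
  ... | inside p< = SchroderBlock-at-++ D Y Y′ b p p< (ss b b∈) isHor at≡ edge
  ... | beyond q  = ⊥-elim (1+n≰n (begin
    suc (countE D)                                 ≤⟨ s≤s (m≤m+n _ _) ⟩
    suc (countE D + countE (take q Y′))            ≡⟨ cong suc (countE-take-length-++ D Y′ q) ⟨
    suc (countE (take (length D + q) (D ++ Y′)))   ≡⟨ edge ⟩
    Block.x b + Block.w b                          ≤⟨ within b b∈ isHor ⟩
    countE D                                       ∎))
    where open ≤-Reasoning
  from : SchroderSlicing (D ++ Y′) bs → SchroderSlicing (D ++ Y) bs
  from ss b b∈ isHor p at≡ = SchroderBlock-at-++ D Y′ Y b p (at-++-count≡0 D Y p E at≡ Y≡0) (ss b b∈) isHor at≡

schroderSlicing-∷ : ∀ L b bs → SchroderSlicing L (b ∷ bs) ⇔ (SchroderBlock L b × SchroderSlicing L bs)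
schroderSlicing-∷ L b bs = mk⇔ (λ ss → ss b (here refl) , λ b′ b′∈ → ss b′ (there b′∈)) from
  where
  from : SchroderBlock L b × SchroderSlicing L bs → SchroderSlicing L (b ∷ bs)
  from (isSchroder , ss) b′ (here refl) = isSchroder
  from (isSchroder , ss) b′ (there b′∈) = ss b′ b′∈

≡⇒⇔ : ∀ {A : Set} (P : A → Set) {x y} → x ≡ y → P x ⇔ P y
≡⇒⇔ P refl = mk⇔ (λ p → p) (λ p → p)

schroder-hstep⇔ : ∀ x r m d → countN x ≡ countN m →
  SchroderCond (hstep x r m d) ⇔ (SchroderAtNewRow m (d ++ N ∷ []) (countE x) × SchroderCond (triple (x ++ replicate r E) m d))
schroder-hstep⇔ x r m d cn = mk⇔ (schroder-hstep⁻¹ x r m d cn) (uncurry (schroder-hstep x r m d cn))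

schroder-vstep⇔ : ∀ u m x r → countE x ≡ countE m →
  SchroderCond (vstep u m x r) ⇔ SchroderCond (triple u m (x ++ replicate r N))
schroder-vstep⇔ u m x r ce = mk⇔ (schroder-vstep⁻¹ u m x r) (schroder-vstep u m x r ce)

atNewRow⇔SchroderBlock : ∀ m d a y → a ≤ countE m →
  SchroderAtNewRow m d a ⇔ SchroderBlock (frame N d) (newRow a y (countE m))
atNewRow⇔SchroderBlock m d a y a≤K = mk⇔ (atNewRow⇒SchroderBlock m d a y a≤K) (SchroderBlock⇒atNewRow m d a y a≤K)

frame-++ : ∀ c x y → frame c (x ++ y) ≡ (other c ∷ x) ++ (y ++ c ∷ [])
frame-++ c x y = cong (other c ∷_) (++-assoc x y (c ∷ []))

countE-frame-++ : ∀ x y → countE y ≡ 0 → countE (frame N (x ++ y)) ≡ countE (E ∷ x)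
countE-frame-++ x y y≡0 = begin
  countE (frame N (x ++ y))                ≡⟨ cong countE (frame-++ N x y) ⟩
  countE ((E ∷ x) ++ (y ++ N ∷ []))        ≡⟨ count-++ E (E ∷ x) _ ⟩
  countE (E ∷ x) + countE (y ++ N ∷ [])    ≡⟨ cong (countE (E ∷ x) +_) (trans (count-∷ʳ E y N) y≡0) ⟩
  countE (E ∷ x) + 0                       ≡⟨ +-identityʳ _ ⟩
  countE (E ∷ x)                           ∎
  where open ≡-Reasoning

schroderSlicing-frame : ∀ x y y′ bs → countE y ≡ 0 → RightEdgesWithin (frame N (x ++ y)) bs →
  SchroderSlicing (frame N (x ++ y)) bs ⇔ SchroderSlicing (frame N (x ++ y′)) bs
schroderSlicing-frame x y y′ bs y≡0 within = begin
  SchroderSlicing (frame N (x ++ y)) bs             ∼⟨ ≡⇒⇔ (λ L → SchroderSlicing L bs) (frame-++ N x y) ⟩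
  SchroderSlicing ((E ∷ x) ++ (y ++ N ∷ [])) bs     ∼⟨ schroderSlicing-++ (E ∷ x) _ _ bs Y≡0 within′ ⟩
  SchroderSlicing ((E ∷ x) ++ (y′ ++ N ∷ [])) bs
    ∼⟨ ≡⇒⇔ (λ L → SchroderSlicing L bs) (sym (frame-++ N x y′)) ⟩
  SchroderSlicing (frame N (x ++ y′)) bs            ∎
  where
  open EquationalReasoning {k = equivalence}
  Y≡0 : countE (y ++ N ∷ []) ≡ 0
  Y≡0 = trans (count-∷ʳ E y N) y≡0
  within′ : RightEdgesWithin (E ∷ x) bs
  within′ b b∈ isHor = ≤-trans (within b b∈ isHor) (≤-reflexive (countE-frame-++ x y y≡0))

schroder⇔-hblock : ∀ {U L bs} (s : BaxterSlicing U L bs) a tl al → SchroderSlicing L bs ⇔ SchroderCond (Φ s) →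
  SchroderSlicing (L ++ N ∷ []) (block hor a (countN U) (countE U ∸ a) 1 ∷ bs) ⇔ SchroderCond (Φ (hblock a s tl al))
schroder⇔-hblock {U} {L} {bs} s a tl al ih = begin
  SchroderSlicing (L ++ N ∷ []) (row ∷ bs)
    ∼⟨ schroderSlicing-∷ _ row bs ⟩
  (SchroderBlock (L ++ N ∷ []) row × SchroderSlicing (L ++ N ∷ []) bs)
    ∼⟨ ⇔-sym row⇔ ×-⇔ ⇔-sym rest⇔ ⟩
  (SchroderAtNewRow m (d ++ N ∷ []) (countE prefix) × SchroderSlicing L bs)
    ∼⟨ ⇔-refl ×-⇔ ⇔-trans ih (≡⇒⇔ SchroderCond Φ-before) ⟩
  (SchroderAtNewRow m (d ++ N ∷ []) (countE prefix) × SchroderCond (triple (prefix ++ replicate run E) m d))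
    ∼⟨ ⇔-sym (schroder-hstep⇔ prefix run m d countN-prefix) ⟩
  SchroderCond (hstep prefix run m d)
    ∼⟨ ≡⇒⇔ SchroderCond (sym Φ-after) ⟩
  SchroderCond (Φ (hblock a s tl al))
    ∎
  where
  open EquationalReasoning {k = equivalence}
  open RowView (rowView s a tl al)
  m = midPath s
  d = inner L
  row = block hor a (countN U) (countE U ∸ a) 1
  nested : Nested (triple (prefix ++ replicate run E) m d)
  nested = subst Nested Φ-before (Φ-nested s)
  countN-prefix : countN prefix ≡ countN m
  countN-prefix = trans (sym (count-++-replicate-other N prefix run))
                        (countN-≡ (prefix ++ replicate run E) m (Nested.length-up nested) (Nested.countE-up nested))
  countE-U : countE U ≡ suc (countE m)
  countE-U = countE-up≡suc-mid s
  row⇔ : SchroderAtNewRow m (d ++ N ∷ []) (countE prefix) ⇔ SchroderBlock (L ++ N ∷ []) row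
  row⇔ = ⇔-trans (≡⇒⇔ (λ a′ → SchroderAtNewRow m (d ++ N ∷ []) a′) countE-prefix)
         (⇔-trans (atNewRow⇔SchroderBlock m (d ++ N ∷ []) a (countN U) (s≤s⁻¹ (subst (a <_) countE-U al)))
                  (≡⇒⇔ (uncurry SchroderBlock)
                       (cong₂ _,_ (sym (cong (_++ N ∷ []) (proj₂ (borders-framed s))))
                                  (cong (λ K → block hor a (countN U) (K ∸ a) 1) (sym countE-U)))))
  rest⇔ : SchroderSlicing L bs ⇔ SchroderSlicing (L ++ N ∷ []) bs
  rest⇔ = ⇔-trans (≡⇒⇔ (λ L′ → SchroderSlicing L′ bs) (sym (++-identityʳ L)))
                  (schroderSlicing-++ L [] (N ∷ []) bs refl (right-edges-within s))

schroder⇔-vblock : ∀ {U L bs} (s : BaxterSlicing U L bs) b rl bl → SchroderSlicing L bs ⇔ SchroderCond (Φ s) →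
  SchroderSlicing (addCol b L) (block ver (countE U) b 1 (countN U ∸ b) ∷ bs) ⇔ SchroderCond (Φ (vblock b s rl bl))
schroder⇔-vblock {U} {L} {bs} s b rl bl ih = begin
  SchroderSlicing (addCol b L) (column ∷ bs)
    ∼⟨ schroderSlicing-∷ _ column bs ⟩
  (SchroderBlock (addCol b L) column × SchroderSlicing (addCol b L) bs)
    ∼⟨ mk⇔ proj₂ (λ ss → (λ ()) , ss) ⟩
  SchroderSlicing (addCol b L) bs
    ∼⟨ ⇔-sym rest⇔ ⟩
  SchroderSlicing L bs
    ∼⟨ ⇔-trans ih (≡⇒⇔ SchroderCond Φ-before) ⟩
  SchroderCond (triple u m (prefix ++ replicate run N))
    ∼⟨ ⇔-sym (schroder-vstep⇔ u m prefix run countE-prefix) ⟩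
  SchroderCond (vstep u m prefix run)
    ∼⟨ ≡⇒⇔ SchroderCond (sym Φ-after) ⟩
  SchroderCond (Φ (vblock b s rl bl))
    ∎
  where
  open EquationalReasoning {k = equivalence}
  open ColumnView (columnView s b rl bl)
  u = inner U
  m = midPath s
  column = block ver (countE U) b 1 (countN U ∸ b)
  countE-prefix : countE prefix ≡ countE m
  countE-prefix = trans (sym (count-++-replicate-other E prefix run))
                        (sym (Nested.countE-down (subst Nested Φ-before (Φ-nested s))))
  L≡ : L ≡ frame N (prefix ++ replicate run N)
  L≡ = trans (proj₂ (borders-framed s)) (cong (λ t → frame N (Triple.down t)) Φ-before)
  L′≡ : addCol b L ≡ frame N (prefix ++ E ∷ replicate run N)
  L′≡ = trans (proj₂ (borders-framed (vblock b s rl bl))) (cong (λ t → frame N (Triple.down t)) Φ-after)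
  rest⇔ : SchroderSlicing L bs ⇔ SchroderSlicing (addCol b L) bs
  rest⇔ = subst₂ (λ L₀ L₁ → SchroderSlicing L₀ bs ⇔ SchroderSlicing L₁ bs) (sym L≡) (sym L′≡)
            (schroderSlicing-frame prefix _ _ bs (count-replicate-other E run)
              (subst (λ L₀ → RightEdgesWithin L₀ bs) L≡ (right-edges-within s)))

schroder⇔ : ∀ {U L bs} (s : BaxterSlicing U L bs) → SchroderSlicing L bs ⇔ SchroderCond (Φ s)
schroder⇔ one                = mk⇔ (λ _ → noNthN) (λ _ → noRow)
  where
  noNthN : SchroderCond (triple [] [] [])
  noNthN i j pu pm pe pd (() , _)
  noRow : SchroderSlicing (E ∷ N ∷ []) (block base 0 0 1 1 ∷ [])
  noRow b (here refl) ()
schroder⇔ (hblock a s tl al) = schroder⇔-hblock s a tl al (schroder⇔ s)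
schroder⇔ (vblock b s rl bl) = schroder⇔-vblock s b rl bl (schroder⇔ s)

-- Bijectivity

++-other∷replicate-injective : ∀ c x x′ r r′ →
  x ++ other c ∷ replicate r c ≡ x′ ++ other c ∷ replicate r′ c → x ≡ x′ × r ≡ r′
++-other∷replicate-injective c []      []       r r′ eq =
  refl , trans (sym (length-replicate r)) (trans (cong length (proj₂ (∷-injective eq))) (length-replicate r′))
++-other∷replicate-injective c []      (y ∷ x′) r r′ eq =
  ⊥-elim (replicate≢++other∷ c r x′ _ (proj₂ (∷-injective eq)))
++-other∷replicate-injective c (y ∷ x) []       r r′ eq =
  ⊥-elim (replicate≢++other∷ c r′ x _ (sym (proj₂ (∷-injective eq))))
++-other∷replicate-injective c (y ∷ x) (y′ ∷ x′) r r′ eq =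
  let (y≡ , rest) = ∷-injective eq
      (x≡ , r≡)   = ++-other∷replicate-injective c x x′ r r′ rest
  in cong₂ _∷_ y≡ x≡ , r≡

hstep-injective : ∀ {x r m d x′ r′ m′ d′} → hstep x r m d ≡ hstep x′ r′ m′ d′ →
  triple (x ++ replicate r E) m d ≡ triple (x′ ++ replicate r′ E) m′ d′ × countE x ≡ countE x′
hstep-injective {x} {r} {m} {d} {x′} {r′} {m′} {d′} eq
  with ++-other∷replicate-injective E x x′ r r′ (cong Triple.up eq)
... | refl , refl =
  cong₂ (triple _) (∷ʳ-injectiveˡ m m′ (cong Triple.mid eq)) (∷ʳ-injectiveˡ d d′ (cong Triple.down eq)) , refl

vstep-injective : ∀ {u m x r u′ m′ x′ r′} → vstep u m x r ≡ vstep u′ m′ x′ r′ →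
  triple u m (x ++ replicate r N) ≡ triple u′ m′ (x′ ++ replicate r′ N) × countN x ≡ countN x′
vstep-injective {u} {m} {x} {r} {u′} {m′} {x′} {r′} eq
  with ++-other∷replicate-injective N x x′ r r′ (cong Triple.down eq)
... | refl , refl =
  cong₂ (λ u₀ m₀ → triple u₀ m₀ _) (∷ʳ-injectiveˡ u u′ (cong Triple.up eq)) (∷ʳ-injectiveˡ m m′ (cong Triple.mid eq)) , refl

hblock-Φ-injective : ∀ {U L bs U′ L′ bs′} {s : BaxterSlicing U L bs} {s′ : BaxterSlicing U′ L′ bs′}
                       {a a′ tl tl′ al al′} →
  Φ (hblock a s tl al) ≡ Φ (hblock a′ s′ tl′ al′) → Φ s ≡ Φ s′ × a ≡ a′
hblock-Φ-injective {s = s} {s′} {a} {a′} {tl} {tl′} {al} {al′} eq =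
  trans V.Φ-before (trans before≡ (sym V′.Φ-before)) , trans (sym V.countE-prefix) (trans countE≡ V′.countE-prefix)
  where
  module V  = RowView (rowView s a tl al)
  module V′ = RowView (rowView s′ a′ tl′ al′)
  after≡ = hstep-injective (trans (sym V.Φ-after) (trans eq V′.Φ-after))
  before≡ = proj₁ after≡
  countE≡ = proj₂ after≡

vblock-Φ-injective : ∀ {U L bs U′ L′ bs′} {s : BaxterSlicing U L bs} {s′ : BaxterSlicing U′ L′ bs′}
                       {b b′ rl rl′ bl bl′} →
  Φ (vblock b s rl bl) ≡ Φ (vblock b′ s′ rl′ bl′) → Φ s ≡ Φ s′ × b ≡ b′
vblock-Φ-injective {s = s} {s′} {b} {b′} {rl} {rl′} {bl} {bl′} eq =
  trans V.Φ-before (trans before≡ (sym V′.Φ-before)) , trans (sym V.countN-prefix) (trans countN≡ V′.countN-prefix)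
  where
  module V  = ColumnView (columnView s b rl bl)
  module V′ = ColumnView (columnView s′ b′ rl′ bl′)
  after≡ = vstep-injective (trans (sym V.Φ-after) (trans eq V′.Φ-after))
  before≡ = proj₁ after≡
  countN≡ = proj₂ after≡

∷ʳ≢[] : ∀ (xs : Path) c → [] ≢ xs ++ c ∷ []
∷ʳ≢[] []       c ()
∷ʳ≢[] (x ∷ xs) c ()

Φ-injective : ∀ {U L bs U′ L′ bs′} (s : BaxterSlicing U L bs) (s′ : BaxterSlicing U′ L′ bs′) → Φ s ≡ Φ s′ →
  U ≡ U′ × L ≡ L′ × bs ≡ bs′
Φ-injective one one _ = refl , refl , refl
Φ-injective one (hblock _ s′ _ _) eq = ⊥-elim (∷ʳ≢[] (midPath s′) N (cong Triple.mid eq))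
Φ-injective one (vblock _ s′ _ _) eq = ⊥-elim (∷ʳ≢[] (midPath s′) E (cong Triple.mid eq))
Φ-injective (hblock _ s _ _) one eq = ⊥-elim (∷ʳ≢[] (midPath s) N (sym (cong Triple.mid eq)))
Φ-injective (vblock _ s _ _) one eq = ⊥-elim (∷ʳ≢[] (midPath s) E (sym (cong Triple.mid eq)))
Φ-injective (hblock _ s _ _) (vblock _ s′ _ _) eq with ∷ʳ-injective (midPath s) (midPath s′) (cong Triple.mid eq)
... | _ , ()
Φ-injective (vblock _ s _ _) (hblock _ s′ _ _) eq with ∷ʳ-injective (midPath s) (midPath s′) (cong Triple.mid eq)
... | _ , ()
Φ-injective (hblock a s tl al) (hblock a′ s′ tl′ al′) eq =
  cong₂ addRow a≡ U≡ , cong (_++ N ∷ []) L≡ ,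
  cong₂ _∷_ (cong₂ (λ a₀ U₀ → block hor a₀ (countN U₀) (countE U₀ ∸ a₀) 1) a≡ U≡) bs≡
  where
  Φ≡×a≡ = hblock-Φ-injective {s = s} {s′} {a} {a′} {tl} {tl′} {al} {al′} eq
  a≡ = proj₂ Φ≡×a≡
  U≡×L≡×bs≡ = Φ-injective s s′ (proj₁ Φ≡×a≡)
  U≡ = proj₁ U≡×L≡×bs≡
  L≡ = proj₁ (proj₂ U≡×L≡×bs≡)
  bs≡ = proj₂ (proj₂ U≡×L≡×bs≡)
Φ-injective (vblock b s rl bl) (vblock b′ s′ rl′ bl′) eq =
  cong (_++ E ∷ []) U≡ , cong₂ addCol b≡ L≡ ,
  cong₂ _∷_ (cong₂ (λ b₀ U₀ → block ver (countE U₀) b₀ 1 (countN U₀ ∸ b₀)) b≡ U≡) bs≡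
  where
  Φ≡×b≡ = vblock-Φ-injective {s = s} {s′} {b} {b′} {rl} {rl′} {bl} {bl′} eq
  b≡ = proj₂ Φ≡×b≡
  U≡×L≡×bs≡ = Φ-injective s s′ (proj₁ Φ≡×b≡)
  U≡ = proj₁ U≡×L≡×bs≡
  L≡ = proj₁ (proj₂ U≡×L≡×bs≡)
  bs≡ = proj₂ (proj₂ U≡×L≡×bs≡)

record Preimage (t : Triple) : Set where
  constructor preimage
  field
    {up down} : Path
    {blocks}  : List Block
    slicing   : BaxterSlicing up down blocks
    Φ≡        : Φ slicing ≡ t

triple-≡ : ∀ {u u′ m m′ d d′} → u ≡ u′ → m ≡ m′ → d ≡ d′ → triple u m d ≡ triple u′ m′ d′
triple-≡ refl refl refl = refl

hblock-preimage : ∀ x r m d → Preimage (triple (x ++ replicate r E) m d) → Preimage (hstep x r m d)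
hblock-preimage x r m d (preimage {U} {L} s Φ≡) = preimage (hblock (countE x) s tl al) (triple-≡ up≡ mid≡ down≡)
  where
  open ValidInsertion (insertion-frame E x r)
  U≡ : U ≡ frame E (x ++ replicate r E)
  U≡ = trans (proj₁ (borders-framed s)) (cong (λ t → frame E (Triple.up t)) Φ≡)
  tl : topStart U ≤ countE x
  tl = subst (λ V → start E V ≤ countE x) (sym U≡) start≤
  al : countE x < countE U
  al = subst (λ V → countE x < countE V) (sym U≡) <count
  up≡ : inner (addRow (countE x) U) ≡ x ++ N ∷ replicate r E
  up≡ = trans (cong (λ V → inner (insertAt E (countE x) V)) U≡) (trans (cong inner inserted) (inner-frame E _))
  mid≡ : midPath s ++ N ∷ [] ≡ m ++ N ∷ []
  mid≡ = cong (λ t → Triple.mid t ++ N ∷ []) Φ≡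
  down≡ : inner (L ++ N ∷ []) ≡ d ++ N ∷ []
  down≡ = trans (inner-framed-∷ʳ (proj₂ (borders-framed s))) (cong (λ t → Triple.down t ++ N ∷ []) Φ≡)

vblock-preimage : ∀ u m x r → Preimage (triple u m (x ++ replicate r N)) → Preimage (vstep u m x r)
vblock-preimage u m x r (preimage {U} {L} s Φ≡) = preimage (vblock (countN x) s rl bl) (triple-≡ up≡ mid≡ down≡)
  where
  open ValidInsertion (insertion-frame N x r)
  L≡ : L ≡ frame N (x ++ replicate r N)
  L≡ = trans (proj₂ (borders-framed s)) (cong (λ t → frame N (Triple.down t)) Φ≡)
  rl : rightStart L ≤ countN x
  rl = subst (λ V → start N V ≤ countN x) (sym L≡) start≤
  bl : countN x < countN L
  bl = subst (λ V → countN x < countN V) (sym L≡) <count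
  up≡ : inner (U ++ E ∷ []) ≡ u ++ E ∷ []
  up≡ = trans (inner-framed-∷ʳ (proj₁ (borders-framed s))) (cong (λ t → Triple.up t ++ E ∷ []) Φ≡)
  mid≡ : midPath s ++ E ∷ [] ≡ m ++ E ∷ []
  mid≡ = cong (λ t → Triple.mid t ++ E ∷ []) Φ≡
  down≡ : inner (addCol (countN x) L) ≡ x ++ E ∷ replicate r N
  down≡ = trans (cong (λ V → inner (insertAt N (countN x) V)) L≡) (trans (cong inner inserted) (inner-frame N _))

nested-preimage : ∀ u m d → Reverse m → Nested (triple u m d) → Preimage (triple u m d)
nested-preimage []      _ []      [] _ = preimage one refl
nested-preimage (_ ∷ _) _ _       [] n with Nested.length-up n
... | ()
nested-preimage []      _ (_ ∷ _) [] n with Nested.length-down n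
... | ()
nested-preimage u _ d (m ∶ rm ∶ʳ N) n with initLast d
... | [] = ⊥-elim (1+n≢0 (sym (trans (Nested.length-down n) (length-∷ʳ m N))))
... | d₀ ∷ʳ′ E = ⊥-elim (≰ᴱ-∷ʳ m d₀ length-m (Nested.countE-down n) (Nested.mid≤ᴱdown n))
  where
  length-m : length m ≡ length d₀
  length-m = suc-injective (trans (sym (length-∷ʳ m N)) (trans (sym (Nested.length-down n)) (length-∷ʳ d₀ E)))
... | d₀ ∷ʳ′ N with split-last N u countN-u≢0
  where
  countN-u≢0 : countN u ≢ 0
  countN-u≢0 u≡0 = 1+n≢0 (begin
    suc (countN m)        ≡⟨ count-∷ʳ N m N ⟨
    countN (m ++ N ∷ [])  ≡⟨ countN-≡ u (m ++ N ∷ []) (Nested.length-up n) (Nested.countE-up n) ⟨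
    countN u              ≡⟨ u≡0 ⟩
    0                     ∎)
    where open ≡-Reasoning
...   | x , r , refl = hblock-preimage x r m d₀ (nested-preimage _ m d₀ rm (nested-hstep⁻¹ x r m d₀ n))
nested-preimage u _ d (m ∶ rm ∶ʳ E) n with initLast u
... | [] = ⊥-elim (1+n≢0 (sym (trans (Nested.length-up n) (length-∷ʳ m E))))
... | u₀ ∷ʳ′ N = ⊥-elim (≰ᴱ-∷ʳ u₀ m length-u₀ (Nested.countE-up n) (Nested.up≤ᴱmid n))
  where
  length-u₀ : length u₀ ≡ length m
  length-u₀ = suc-injective (trans (sym (length-∷ʳ u₀ N)) (trans (Nested.length-up n) (length-∷ʳ m E)))
... | u₀ ∷ʳ′ E with split-last E d countE-d≢0
  where
  countE-d≢0 : countE d ≢ 0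
  countE-d≢0 d≡0 = 1+n≢0 (begin
    suc (countE m)        ≡⟨ count-∷ʳ E m E ⟨
    countE (m ++ E ∷ [])  ≡⟨ Nested.countE-down n ⟩
    countE d              ≡⟨ d≡0 ⟩
    0                     ∎)
    where open ≡-Reasoning
...   | x , r , refl = vblock-preimage u₀ m x r (nested-preimage u₀ m _ rm (nested-vstep⁻¹ u₀ m x r n))

Φ-schroderTriple : ∀ {U L bs} (s : BaxterSlicing U L bs) → SchroderSlicing L bs → SchroderTriple (length bs) (Φ s)
Φ-schroderTriple s ss =
  subst (λ n → NITriple n (Φ s)) (sym (length-blocks s)) (nested⇒NITriple (Φ-nested s)) ,
  Equivalence.to (schroder⇔ s) ss

schroderTriple-preimage : ∀ n t → SchroderTriple n t →
  Σ Path λ U → Σ Path λ L → Σ (List Block) λ bs → Σ (BaxterSlicing U L bs) λ s →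
  SchroderSlicing L bs × length bs ≡ n × Φ s ≡ t
schroderTriple-preimage n (triple u m d) (ni , sc) =
  _ , _ , _ , slicing , Equivalence.from (schroder⇔ slicing) (subst SchroderCond (sym Φ≡) sc) ,
  trans (length-blocks slicing) (trans (cong (λ t → suc (length (Triple.mid t))) Φ≡) (NITriple.len-m ni)) , Φ≡
  where open Preimage (nested-preimage u m d (reverseView m) (NITriple⇒nested ni))

theorem6 :
  (∀ {U L bs} (s : BaxterSlicing U L bs) → SchroderSlicing L bs →
    SchroderTriple (length bs) (Φ s))
  × (∀ (n : ℕ) (t : Triple) → SchroderTriple n t →
    Σ Path λ U → Σ Path λ L → Σ (List Block) λ bs →
    Σ (BaxterSlicing U L bs) λ s →
    SchroderSlicing L bs × length bs ≡ n × Φ s ≡ t)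
  × (∀ {U L bs U′ L′ bs′} (s : BaxterSlicing U L bs) (s′ : BaxterSlicing U′ L′ bs′) →
    SchroderSlicing L bs → SchroderSlicing L′ bs′ → Φ s ≡ Φ s′ →
    U ≡ U′ × L ≡ L′ × bs ↭ bs′)
theorem6 = Φ-schroderTriple , schroderTriple-preimage , injective
  where
  -- Φ is injective on all Baxter slicings.
  injective : ∀ {U L bs U′ L′ bs′} (s : BaxterSlicing U L bs) (s′ : BaxterSlicing U′ L′ bs′) →
              SchroderSlicing L bs → SchroderSlicing L′ bs′ → Φ s ≡ Φ s′ → U ≡ U′ × L ≡ L′ × bs ↭ bs′
  injective s s′ _ _ eq = let (U≡ , L≡ , bs≡) = Φ-injective s s′ eq in U≡ , L≡ , ↭-reflexive bs≡
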